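{- Let $(\mathfrak{M}_X,m)$ be an arithmetic matroid on a finite list $X$ with a fixed total order on $X$. Then for every basis $B$ of $\mathfrak{M}_X$ there exists an equidistributed matching $\psi_B$ between $\mathcal{B}_B$ and $\mathcal{B}^*_{B^c}$, i.e. a bijection from the $m(B)$ copies in $\mathcal{B}_B$ to the $m(B)$ copies in $\mathcal{B}^*_{B^c}$ such that for all classes $\alpha,\beta$ the number of copies of class $\alpha$ sent to copies of class $\beta$ equals $n_B(\alpha)n^*_B(\beta)/m(B)$.
   Context: Lists are finite multisets; sublists, unions, intersections and complements are taken as sublists. A matroid on a list $X$ is given by a rank function $rk$ with $rk(A)\le|A|$, monotonicity and submodularity; bases are the sublists $B$ with $|B|=rk(B)=rk(X)$; the dual rank is $rk^*(A)=|A|-rk(X)+rk(X\setminus A)$, whose bases are the complements $B^c=X\setminus B$. $v$ is dependent on $A$ if $rk(A\cup\{v\})=rk(A)$, independent if $rk(A\cup\{v\})=rk(A)+1$. An arithmetic matroid is a matroid with $m$ from sublists to positive integers such that: (1) if $v$ is dependent on $A$ then $m(A\cup\{v\})\mid m(A)$; (2) if $v$ is independent on $A$ then $m(A)\mid m(A\cup\{v\})$; (3) if $A\subseteq B\subseteq X$, $B=A\cup F\cup T$ disjointly, and $rk(C)=rk(A)+|C\cap F|$ for all $A\subseteq C\subseteq B$, then $m(A)m(B)=m(A\cup F)m(A\cup T)$; (4) if $A\subseteq B$, $rk(A)=rk(B)$, then $\sum_{A\subseteq T\subseteq B}(-1)^{|T|-|A|}m(T)\ge0$; (5) if $A\subseteq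 B$, $rk^*(A)=rk^*(B)$, then $\sum_{A\subseteq T\subseteq B}(-1)^{|T|-|A|}m(X\setminus T)\ge0$. For $S$ with $rk(S)=rk(X)$, $\mu(S)=\sum_{S\subseteq T\subseteq X}(-1)^{|T|-|S|}m(T)$; for $S$ with $rk^*(S)=rk^*(X)$, $\mu^*(S)=\sum_{S\subseteq T\subseteq X}(-1)^{|T|-|S|}m(X\setminus T)$. $\mathcal{B}_B$ is the list of pairs $(B,T)$, $B\subseteq T\subseteq X$, each appearing $\mu(T)$ times; $\mathcal{B}^*_{B^c}$ is the list of pairs $(B^c,\widetilde T)$, $B^c\subseteq \widetilde T\subseteq X$, each appearing $\mu^*(\widetilde T)$ times. Each list has $m(B)$ elements with multiplicity. With respect to the total order, $v\in X\setminus B$ is externally active on $B$ if $v$ is dependent on $\{b\in B:b>v\}$; $v\in B$ is externally active on $B^c$ (in the dual) if $rk^*(C'\cup\{v\})=rk^*(C')$ with $C'=\{w\in B^c:w>v\}$. The class of $(B,T)$ is the sublist $\alpha$ of elements of $T\setminus B$ externally active on $B$, and $n_B(\alpha)$ is the number of copies in $\mathcal{B}_B$ of class $\alpha$; the class of $(B^c,\widetilde T)$ is the sublist $\beta$ of elements of $\widetilde T\setminus B^c$ externally active on $B^c$, and $n^*_B(\beta)$ the number of copies in $\mathcal{B}^*_{B^c}$ of class $\beta$. -}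

module Defs where

open import Data.Bool using (Bool; true; false; if_then_else_; not; _∧_)
open import Data.Nat using (ℕ; zero; suc; _+_; _*_; _∸_; _≤_; _<_)
import Data.Nat as ℕ
open import Data.Integer as ℤ using (ℤ; +_; -[1+_])
open import Data.Fin using (Fin)
import Data.Fin as Fin
open import Data.Fin.Subset using (Subset; ⊥; ⊤; ⁅_⁆; _⊆_; ∁; _∩_; _∪_; ∣_∣)
open import Data.Fin.Subset.Properties using (_⊆?_)
open import Data.Vec using (Vec; []; _∷_; tabulate)
open import Data.Vec.Properties using (≡-dec)
open import Data.List using (List; []; _∷_; _++_; map; concatMap; allFin; foldr)
open import Data.Product using (Σ; _,_; proj₁; proj₂)
open import Relation.Nullary using (does)
open import Relation.Binary.PropositionalEquality using (_≡_)
import Data.Bool as Bool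
open import Data.Nat.Divisibility using (_∣_)

-- The list X is represented by its n positions Fin n; sublists of X are
-- subsets of positions (Subset n = Vec Bool n).  The fixed total order on
-- X is the order of positions in Fin n.

_≟ₛ_ : ∀ {n} (A C : Subset n) → Relation.Nullary.Dec (A ≡ C)
_≟ₛ_ = ≡-dec Bool._≟_

allSubsets : ∀ n → List (Subset n)
allSubsets zero = [] ∷ []
allSubsets (suc n) = map (true ∷_) (allSubsets n) ++ map (false ∷_) (allSubsets n)

count : ∀ {a} {A : Set a} → (A → Bool) → List A → ℕ
count p [] = 0
count p (x ∷ xs) = if p x then suc (count p xs) else count p xs

sumℤ : List ℤ → ℤ
sumℤ = foldr ℤ._+_ (+ 0)

sign : ℕ → ℤ
sign k = (ℤ.- (+ 1)) ℤ.^ k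

altSum : ∀ {n} → (Subset n → ℤ) → Subset n → Subset n → ℤ
altSum {n} f A B =
  sumℤ (map (λ T → if does (A ⊆? T) ∧ does (T ⊆? B)
                   then sign (∣ T ∣ ∸ ∣ A ∣) ℤ.* f T
                   else + 0)
            (allSubsets n))

record ArithmeticMatroid (n : ℕ) : Set where
  field
    rk : Subset n → ℕ
    m  : Subset n → ℕ
    rk-≤card   : ∀ A → rk A ≤ ∣ A ∣
    rk-mono    : ∀ A C → A ⊆ C → rk A ≤ rk C
    rk-submod  : ∀ A C → rk (A ∪ C) + rk (A ∩ C) ≤ rk A + rk C
    m-pos      : ∀ A → 0 < m A

  rk* : Subset n → ℕ
  rk* A = (∣ A ∣ + rk (∁ A)) ∸ rk ⊤

  field
    ax1 : ∀ A v → rk (A ∪ ⁅ v ⁆) ≡ rk A → m (A ∪ ⁅ v ⁆) ∣ m A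
    ax2 : ∀ A v → rk (A ∪ ⁅ v ⁆) ≡ suc (rk A) → m A ∣ m (A ∪ ⁅ v ⁆)
    ax3 : ∀ A F T → A ∩ F ≡ ⊥ → A ∩ T ≡ ⊥ → F ∩ T ≡ ⊥ →
          (∀ C → A ⊆ C → C ⊆ ((A ∪ F) ∪ T) → rk C ≡ rk A + ∣ C ∩ F ∣) →
          m A * m ((A ∪ F) ∪ T) ≡ m (A ∪ F) * m (A ∪ T)
    ax4 : ∀ A B → A ⊆ B → rk A ≡ rk B →
          + 0 ℤ.≤ altSum (λ T → + m T) A B
    ax5 : ∀ A B → A ⊆ B → rk* A ≡ rk* B →
          + 0 ℤ.≤ altSum (λ T → + m (∁ T)) A B

module _ {n : ℕ} (M : ArithmeticMatroid n) where
  open ArithmeticMatroid M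

  IsBasis : Subset n → Set
  IsBasis B = (∣ B ∣ ≡ rk B) Data.Product.× (rk B ≡ rk ⊤)

  μ : Subset n → ℤ
  μ S = altSum (λ T → + m T) S ⊤

  μ* : Subset n → ℤ
  μ* S = altSum (λ T → + m (∁ T)) S ⊤

  above : Fin n → Subset n → Subset n
  above v C = C ∩ tabulate (λ w → does (v Fin.<? w))

  activeSet : Subset n → Subset n
  activeSet B = tabulate (λ v →
    not (does (v Data.Fin.Subset.Properties.∈? B)) ∧
    does (rk (above v B ∪ ⁅ v ⁆) ℕ.≟ rk (above v B)))

  -- elements of B externally active on Bᶜ in the dual matroid
  dualActiveSet : Subset n → Subset n
  dualActiveSet B = tabulate (λ v →
    does (v Data.Fin.Subset.Properties.∈? B) ∧
    does (rk* (above v (∁ B) ∪ ⁅ v ⁆) ℕ.≟ rk* (above v (∁ B))))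

  -- number of copies of the pair (B , T) in 𝓑_B, resp. of (Bᶜ , T̃) in 𝓑*_{Bᶜ}
  -- (μ(T) ≥ 0, μ*(T̃) ≥ 0 by axioms (4),(5); ∣_∣ is the absolute value)
  mult : Subset n → Subset n → ℕ
  mult B T = if does (B ⊆? T) then ℤ.∣ μ T ∣ else 0

  dmult : Subset n → Subset n → ℕ
  dmult B T̃ = if does (∁ B ⊆? T̃) then ℤ.∣ μ* T̃ ∣ else 0

  -- the lists 𝓑_B and 𝓑*_{Bᶜ}: a copy is a sublist T together with the
  -- index of the copy
  Copies : Subset n → Set
  Copies B = Σ (Subset n) (λ T → Fin (mult B T))

  DualCopies : Subset n → Set
  DualCopies B = Σ (Subset n) (λ T̃ → Fin (dmult B T̃))

  copiesList : (B : Subset n) → List (Copies B)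
  copiesList B = concatMap (λ T → map (T ,_) (allFin (mult B T))) (allSubsets n)

  dualCopiesList : (B : Subset n) → List (DualCopies B)
  dualCopiesList B = concatMap (λ T̃ → map (T̃ ,_) (allFin (dmult B T̃))) (allSubsets n)

  cls : (B : Subset n) → Copies B → Subset n
  cls B (T , _) = (T ∩ ∁ B) ∩ activeSet B

  dcls : (B : Subset n) → DualCopies B → Subset n
  dcls B (T̃ , _) = (T̃ ∩ B) ∩ dualActiveSet B

  nB : Subset n → Subset n → ℕ
  nB B α = count (λ x → does (cls B x ≟ₛ α)) (copiesList B)

  nB* : Subset n → Subset n → ℕ
  nB* B β = count (λ y → does (dcls B y ≟ₛ β)) (dualCopiesList B)

-- The m(B) copies of 𝓑_B fall into classes of sizes n_B(α), those of 𝓑*_{Bᶜ} into classes of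
-- sizes n*_B(β), and any table of naturals with these margins is the joint class distribution
-- of some bijection between the two lists (greedy matching).  The table
-- n_B(α) n*_B(β) / m(B) has the right margins, so it suffices that m(B) divides n_B(α) n*_B(β).
-- Möbius inversion writes n_B(α) = Σ_U κ_α(U) m(U) and n*_B(β) = Σ_V κ*_β(V) m(Vᶜ), where κ_α(U) ≠ 0
-- only if B ⊆ U and U ∖ B is externally active, and κ*_β(V) ≠ 0 only if Bᶜ ⊆ V and V ∩ B is
-- dually externally active.  For such U and V axiom (3) gives m(U) m(Vᶜ) = m(B) m(Vᶜ ∪ (U ∖ B)):
-- its rank condition holds because an externally active element is spanned by every part of B
-- that contains all elements of B that are not dually externally active.

module Submission where

open import Defs
open import Algebra.Bundles using (CommutativeSemiring)
open import Data.Bool using (Bool; true; false; _∧_; not)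
open import Data.Fin using (Fin; zero; suc; punchIn; _↑ˡ_; _↑ʳ_; splitAt; join)
open import Data.Fin.Permutation as Perm using (Permutation′; _⟨$⟩ʳ_; insert-punchIn)
open import Data.Fin.Properties using (splitAt-↑ˡ; splitAt-↑ʳ; join-splitAt)
open import Data.Fin.Subset using (Subset)
open import Data.List using (List; []; _∷_; _++_; foldr; map; concatMap; allFin)
open import Data.List.Properties using (map-++; map-∘; map-cong)
open import Data.Nat using (ℕ; zero; suc; NonZero)
open import Data.Nat.Divisibility using (_∣_; divides; quotient)
import Data.Integer.Properties as ℤ
import Data.Nat.Properties
open import Data.Product using (Σ; ∃-syntax; _,_; proj₁; proj₂; _×_)
open import Data.Sum using (inj₁; inj₂; [_,_]′)
open import Data.Vec using ([]; _∷_)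
open import Data.Empty using (⊥-elim)
open import Function using (_∘_)
open import Function.Bundles using (_↔_; _⤖_; mk↔ₛ′; Inverse; Bijection)
open import Function.Properties.Inverse using (↔⇒⤖; ↔-trans; ↔-sym)
open import Relation.Nullary using (Dec; does; yes; no; ¬_)
open import Relation.Nullary.Decidable using (dec-true)
import Relation.Binary.PropositionalEquality as ≡

_≡ᵇ_ : ∀ {n} → Subset n → Subset n → Bool
S ≡ᵇ T = does (S ≟ₛ T)

module SubsetSum {c ℓ} (R : CommutativeSemiring c ℓ) where
  open CommutativeSemiring R
  open import Algebra.Properties.CommutativeSemigroup +-commutativeSemigroup using (interchange)

  𝟙 : Bool → Carrier
  𝟙 true = 1#
  𝟙 false = 0#

  𝟙-∧ : ∀ a b → 𝟙 (a ∧ b) ≈ 𝟙 a * 𝟙 b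
  𝟙-∧ true b = sym (*-identityˡ (𝟙 b))
  𝟙-∧ false b = sym (zeroˡ (𝟙 b))

  ∑ₛ : ∀ {n} → (Subset n → Carrier) → Carrier
  ∑ₛ {zero} f = f []
  ∑ₛ {suc n} f = ∑ₛ (f ∘ (true ∷_)) + ∑ₛ (f ∘ (false ∷_))

  ∑ₛ-cong : ∀ {n} {f g : Subset n → Carrier} → (∀ S → f S ≈ g S) → ∑ₛ f ≈ ∑ₛ g
  ∑ₛ-cong {zero} f≈g = f≈g []
  ∑ₛ-cong {suc n} f≈g = +-cong (∑ₛ-cong (f≈g ∘ (true ∷_))) (∑ₛ-cong (f≈g ∘ (false ∷_)))

  ∑ₛ-zero : ∀ n → ∑ₛ {n} (λ _ → 0#) ≈ 0#
  ∑ₛ-zero zero = refl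
  ∑ₛ-zero (suc n) = trans (+-cong (∑ₛ-zero n) (∑ₛ-zero n)) (+-identityˡ 0#)

  ∑ₛ-zeroˡ : ∀ {n} (g : Subset n → Carrier) → ∑ₛ (λ T → 0# * g T) ≈ 0#
  ∑ₛ-zeroˡ {n} g = trans (∑ₛ-cong (λ T → zeroˡ (g T))) (∑ₛ-zero n)

  ∑ₛ-distrib-+ : ∀ {n} (f g : Subset n → Carrier) → ∑ₛ (λ S → f S + g S) ≈ ∑ₛ f + ∑ₛ g
  ∑ₛ-distrib-+ {zero} f g = refl
  ∑ₛ-distrib-+ {suc n} f g =
    trans (+-cong (∑ₛ-distrib-+ (f ∘ (true ∷_)) (g ∘ (true ∷_)))
                  (∑ₛ-distrib-+ (f ∘ (false ∷_)) (g ∘ (false ∷_))))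
          (interchange _ _ _ _)

  ∑ₛ-*ˡ : ∀ {n} x (f : Subset n → Carrier) → ∑ₛ (λ S → x * f S) ≈ x * ∑ₛ f
  ∑ₛ-*ˡ {zero} x f = refl
  ∑ₛ-*ˡ {suc n} x f = trans (+-cong (∑ₛ-*ˡ x (f ∘ (true ∷_))) (∑ₛ-*ˡ x (f ∘ (false ∷_)))) (sym (distribˡ x _ _))

  ∑ₛ-*ʳ : ∀ {n} x (f : Subset n → Carrier) → ∑ₛ (λ S → f S * x) ≈ ∑ₛ f * x
  ∑ₛ-*ʳ x f = trans (∑ₛ-cong (λ S → *-comm (f S) x)) (trans (∑ₛ-*ˡ x f) (*-comm x _))

  ∑ₛ-comm : ∀ {n k} (F : Subset n → Subset k → Carrier) →
            ∑ₛ (λ S → ∑ₛ (F S)) ≈ ∑ₛ (λ T → ∑ₛ (λ S → F S T))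
  ∑ₛ-comm {zero} F = refl
  ∑ₛ-comm {suc n} F =
    trans (+-cong (∑ₛ-comm (F ∘ (true ∷_))) (∑ₛ-comm (F ∘ (false ∷_))))
          (sym (∑ₛ-distrib-+ (λ T → ∑ₛ (λ S → F (true ∷ S) T)) (λ T → ∑ₛ (λ S → F (false ∷ S) T))))

  ∑ₛ-indicator : ∀ {n} (S : Subset n) (f : Subset n → Carrier) →
                 ∑ₛ (λ T → 𝟙 (S ≡ᵇ T) * f T) ≈ f S
  ∑ₛ-indicator {zero} [] f = *-identityˡ (f [])
  ∑ₛ-indicator {suc n} (true ∷ S) f =
    trans (+-cong (∑ₛ-indicator S (f ∘ (true ∷_))) (∑ₛ-zeroˡ (f ∘ (false ∷_)))) (+-identityʳ _)
  ∑ₛ-indicator {suc n} (false ∷ S) f =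
    trans (+-cong (∑ₛ-zeroˡ (f ∘ (true ∷_))) (∑ₛ-indicator S (f ∘ (false ∷_)))) (+-identityˡ _)

  foldr-+-++ : ∀ (xs ys : List Carrier) → foldr _+_ 0# (xs ++ ys) ≈ foldr _+_ 0# xs + foldr _+_ 0# ys
  foldr-+-++ [] ys = sym (+-identityˡ _)
  foldr-+-++ (x ∷ xs) ys = trans (+-congˡ (foldr-+-++ xs ys)) (sym (+-assoc x _ _))

  ∑ₛ-allSubsets : ∀ n (f : Subset n → Carrier) → foldr _+_ 0# (map f (allSubsets n)) ≈ ∑ₛ f
  ∑ₛ-allSubsets zero f = +-identityʳ (f [])
  ∑ₛ-allSubsets (suc n) f = begin
    foldr _+_ 0# (map f (map (true ∷_) (allSubsets n) ++ map (false ∷_) (allSubsets n)))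
      ≡⟨ ≡.cong (foldr _+_ 0#) (map-++ f (map (true ∷_) (allSubsets n)) _) ⟩
    foldr _+_ 0# (map f (map (true ∷_) (allSubsets n)) ++ map f (map (false ∷_) (allSubsets n)))
      ≈⟨ foldr-+-++ (map f (map (true ∷_) (allSubsets n))) _ ⟩
    foldr _+_ 0# (map f (map (true ∷_) (allSubsets n))) + foldr _+_ 0# (map f (map (false ∷_) (allSubsets n)))
      ≡⟨ ≡.cong₂ (λ xs ys → foldr _+_ 0# xs + foldr _+_ 0# ys) (map-∘ (allSubsets n)) (map-∘ (allSubsets n)) ⟨
    foldr _+_ 0# (map (f ∘ (true ∷_)) (allSubsets n)) + foldr _+_ 0# (map (f ∘ (false ∷_)) (allSubsets n))
      ≈⟨ +-cong (∑ₛ-allSubsets n (f ∘ (true ∷_))) (∑ₛ-allSubsets n (f ∘ (false ∷_))) ⟩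
    ∑ₛ f ∎
    where open import Relation.Binary.Reasoning.Setoid setoid

  ∑ₛ-𝟙 : ∀ {n} (S : Subset n) → ∑ₛ (λ T → 𝟙 (S ≡ᵇ T)) ≈ 1#
  ∑ₛ-𝟙 S = trans (∑ₛ-cong (λ T → sym (*-identityʳ (𝟙 (S ≡ᵇ T))))) (∑ₛ-indicator S (λ _ → 1#))

open import Relation.Binary.PropositionalEquality

module ℕΣ = SubsetSum Data.Nat.Properties.+-*-commutativeSemiring
module ℤΣ = SubsetSum ℤ.+-*-commutativeSemiring

≡ᵇ-refl : ∀ {n} (S : Subset n) → S ≡ᵇ S ≡ true
≡ᵇ-refl S = dec-true (S ≟ₛ S) refl

does⇒ : ∀ {a} {A : Set a} (A? : Dec A) → does A? ≡ true → A
does⇒ (yes a) _ = a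

not-does⇒ : ∀ {a} {A : Set a} (A? : Dec A) → not (does A?) ≡ true → ¬ A
not-does⇒ (no ¬a) _ = ¬a

≡ᵇ⇒≡ : ∀ {n} {S T : Subset n} → S ≡ᵇ T ≡ true → S ≡ T
≡ᵇ⇒≡ {S = S} {T} = does⇒ (S ≟ₛ T)

module SubsetFacts where
  open import Data.Nat using (_+_)
  open import Data.Nat.Properties using (+-suc)
  open import Data.Fin.Subset using (⊥; ⁅_⁆; _∪_; _∩_; ∁; _⊆_; _∈_; _∉_; ∣_∣)
  open import Data.Fin.Subset.Properties
    using (∪-identityʳ; drop-there; ⊆-antisym; p∩q⊆p; p∩q⊆q; x∈p∩q⁺; x∈p∩q⁻; Empty-unique; p⊆p∪q; q⊆p∪q;
           x∈p∪q⁻; x∈⁅x⁆; x∈⁅y⁆⇒x≡y; x∉p⇒x∈∁p; x∈∁p⇒x∉p; _∈?_; ∉⊥)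
  open import Data.Vec using (here; there; tabulate)
  open import Data.Vec.Properties using (lookup∘tabulate; []=⇒lookup)
  import Data.Fin as Fin

  subset-induction : ∀ {ℓ n} (P : Subset n → Set ℓ) → P ⊥ →
                     (∀ S d → d ∉ S → P S → P (S ∪ ⁅ d ⁆)) → ∀ S → P S
  subset-induction {n = zero} P P⊥ step [] = P⊥
  subset-induction {n = suc n} P P⊥ step (b ∷ S) = P-∷ b
    where
    P-false∷ : ∀ S → P (false ∷ S)
    P-false∷ = subset-induction (P ∘ (false ∷_)) P⊥
                 (λ S d d∉S → step (false ∷ S) (suc d) (d∉S ∘ drop-there))
    P-∷ : ∀ b → P (b ∷ S)
    P-∷ false = P-false∷ S
    P-∷ true = subst (P ∘ (true ∷_)) (∪-identityʳ S) (step (false ∷ S) zero (λ ()) (P-false∷ S))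

  ∣∩∣+∣∩∁∣ : ∀ {n} (C B : Subset n) → ∣ C ∩ B ∣ + ∣ C ∩ ∁ B ∣ ≡ ∣ C ∣
  ∣∩∣+∣∩∁∣ [] [] = refl
  ∣∩∣+∣∩∁∣ (true ∷ C) (true ∷ B) = cong suc (∣∩∣+∣∩∁∣ C B)
  ∣∩∣+∣∩∁∣ (true ∷ C) (false ∷ B) = trans (+-suc ∣ C ∩ B ∣ ∣ C ∩ ∁ B ∣) (cong suc (∣∩∣+∣∩∁∣ C B))
  ∣∩∣+∣∩∁∣ (false ∷ C) (b ∷ B) = ∣∩∣+∣∩∁∣ C B

  ∩∪∩∁ : ∀ {n} (C B : Subset n) → (C ∩ B) ∪ (C ∩ ∁ B) ≡ C
  ∩∪∩∁ [] [] = refl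
  ∩∪∩∁ (true ∷ C) (true ∷ B) = cong (true ∷_) (∩∪∩∁ C B)
  ∩∪∩∁ (true ∷ C) (false ∷ B) = cong (true ∷_) (∩∪∩∁ C B)
  ∩∪∩∁ (false ∷ C) (b ∷ B) = cong (false ∷_) (∩∪∩∁ C B)

  ∣∪⁅⁆∣ : ∀ {n} {x} {p : Subset n} → x ∉ p → ∣ p ∪ ⁅ x ⁆ ∣ ≡ suc ∣ p ∣
  ∣∪⁅⁆∣ {x = zero} {false ∷ p} x∉p = cong (suc ∘ ∣_∣) (∪-identityʳ p)
  ∣∪⁅⁆∣ {x = zero} {true ∷ p} x∉p = ⊥-elim (x∉p here)
  ∣∪⁅⁆∣ {x = suc x} {true ∷ p} x∉p = cong suc (∣∪⁅⁆∣ (x∉p ∘ there))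
  ∣∪⁅⁆∣ {x = suc x} {false ∷ p} x∉p = ∣∪⁅⁆∣ (x∉p ∘ there)

  disjoint : ∀ {n} {p q : Subset n} → (∀ {x} → x ∈ p → x ∉ q) → p ∩ q ≡ ⊥
  disjoint {p = p} {q} p∩q=∅ = Empty-unique (λ (x , x∈p∩q) → let (x∈p , x∈q) = x∈p∩q⁻ p q x∈p∩q in p∩q=∅ x∈p x∈q)

  ⊆⇒∩≡ : ∀ {n} {S P : Subset n} → S ⊆ P → P ∩ S ≡ S
  ⊆⇒∩≡ S⊆P = ⊆-antisym (p∩q⊆q _ _) (λ x∈S → x∈p∩q⁺ (S⊆P x∈S , x∈S))

  ⊆⇒∪∩∁≡ : ∀ {n} {p q : Subset n} → p ⊆ q → p ∪ (q ∩ ∁ p) ≡ q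
  ⊆⇒∪∩∁≡ {p = p} {q} p⊆q = trans (cong (_∪ (q ∩ ∁ p)) (sym (⊆⇒∩≡ p⊆q))) (∩∪∩∁ q p)

  p∩∁⊥≡p : ∀ {n} (p : Subset n) → p ∩ ∁ ⊥ ≡ p
  p∩∁⊥≡p p = ⊆-antisym (p∩q⊆p p (∁ ⊥)) (λ x∈p → x∈p∩q⁺ (x∈p , x∉p⇒x∈∁p ∉⊥))

  p∩∁[p∩∁q]⊆q : ∀ {n} (p q : Subset n) → p ∩ ∁ (p ∩ ∁ q) ⊆ q
  p∩∁[p∩∁q]⊆q p q {x} x∈ with x ∈? q
  ... | yes x∈q = x∈q
  ... | no x∉q = ⊥-elim (x∈∁p⇒x∉p (p∩q⊆q p _ x∈) (x∈p∩q⁺ (p∩q⊆p p _ x∈ , x∉p⇒x∈∁p x∉q)))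

  ∁[p∪⁅x⁆]∪⁅x⁆≡∁p : ∀ {n} {p : Subset n} {x} → x ∉ p → ∁ (p ∪ ⁅ x ⁆) ∪ ⁅ x ⁆ ≡ ∁ p
  ∁[p∪⁅x⁆]∪⁅x⁆≡∁p {p = p} {x} x∉p = ⊆-antisym
    (λ y∈ → [ (λ y∈∁[p∪x] → x∉p⇒x∈∁p (x∈∁p⇒x∉p y∈∁[p∪x] ∘ p⊆p∪q ⁅ x ⁆))
            , (λ y∈x → x∉p⇒x∈∁p (x∉p ∘ subst (_∈ p) (x∈⁅y⁆⇒x≡y x y∈x))) ]′ (x∈p∪q⁻ _ ⁅ x ⁆ y∈))
    (λ {y} y∈∁p → case-≡x y∈∁p (y Fin.≟ x))
    where
    case-≡x : ∀ {y} → y ∈ ∁ p → Dec (y ≡ x) → y ∈ ∁ (p ∪ ⁅ x ⁆) ∪ ⁅ x ⁆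
    case-≡x _ (yes refl) = q⊆p∪q _ ⁅ x ⁆ (x∈⁅x⁆ x)
    case-≡x y∈∁p (no y≢x) = p⊆p∪q ⁅ x ⁆ (x∉p⇒x∈∁p (λ y∈ →
      [ x∈∁p⇒x∉p y∈∁p , y≢x ∘ x∈⁅y⁆⇒x≡y x ]′ (x∈p∪q⁻ p ⁅ x ⁆ y∈)))

  ∁∁ : ∀ {n} (p : Subset n) → ∁ (∁ p) ≡ p
  ∁∁ [] = refl
  ∁∁ (true ∷ p) = cong (true ∷_) (∁∁ p)
  ∁∁ (false ∷ p) = cong (false ∷_) (∁∁ p)

  ∈tabulate⁻ : ∀ {n} {f : Fin n → Bool} {x} → x ∈ tabulate f → f x ≡ true
  ∈tabulate⁻ {f = f} {x} x∈ = trans (sym (lookup∘tabulate f x)) ([]=⇒lookup x∈)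

module Realisation where
  open ℕΣ
  open import Data.Nat using (_+_; _*_; _∸_; _≤_; _<_; z≤n; s≤s)
  open import Data.Nat.Properties
    using (≤-refl; ≤-trans; ≤-reflexive; m≤m+n; m≤n+m; n≤0⇒n≡0; m∸n+n≡m; +-comm; +-cancelʳ-≡;
           *-cancelʳ-≡; *-identityˡ; *-identityʳ; *-zeroʳ; *-comm; +-0-commutativeMonoid)
  open import Algebra.Properties.CommutativeMonoid.Sum +-0-commutativeMonoid
    using (sum; sum-remove; sum-cong-≗)

  countᶠ : ∀ {k} → (Fin k → Bool) → ℕ
  countᶠ p = sum (λ i → 𝟙 (p i))

  countᶠ-positive : ∀ {k} (p : Fin k → Bool) → 0 < countᶠ p → ∃[ i ] p i ≡ true
  countᶠ-positive {suc k} p pos with p zero in eq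
  ... | true = zero , eq
  ... | false = let (i , pi) = countᶠ-positive (p ∘ suc) pos in suc i , pi

  countᶠ-const : ∀ k b → countᶠ {k} (λ _ → b) ≡ 𝟙 b * k
  countᶠ-const zero b = sym (*-zeroʳ (𝟙 b))
  countᶠ-const (suc k) true =
    trans (cong suc (trans (countᶠ-const k true) (*-identityˡ k))) (sym (*-identityˡ (suc k)))
  countᶠ-const (suc k) false = countᶠ-const k false

  ∑ₛ-≤ : ∀ {n} (f : Subset n → ℕ) S → f S ≤ ∑ₛ f
  ∑ₛ-≤ {zero} f [] = ≤-refl
  ∑ₛ-≤ {suc n} f (true ∷ S) = ≤-trans (∑ₛ-≤ (f ∘ (true ∷_)) S) (m≤m+n _ _)
  ∑ₛ-≤ {suc n} f (false ∷ S) = ≤-trans (∑ₛ-≤ (f ∘ (false ∷_)) S) (m≤n+m _ _)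

  ∑ₛ-positive : ∀ {n} (f : Subset n → ℕ) → 0 < ∑ₛ f → ∃[ S ] 0 < f S
  ∑ₛ-positive {zero} f pos = [] , pos
  ∑ₛ-positive {suc n} f pos with ∑ₛ (f ∘ (true ∷_)) in eq
  ... | zero = let (S , fS) = ∑ₛ-positive (f ∘ (false ∷_)) pos in false ∷ S , fS
  ... | suc _ = let (S , fS) = ∑ₛ-positive (f ∘ (true ∷_)) (≤-trans (s≤s z≤n) (≤-reflexive (sym eq)))
                in true ∷ S , fS

  ∑ₛ-countᶠ : ∀ {n k} (h : Fin k → Subset n) → ∑ₛ (λ β → countᶠ (λ i → h i ≡ᵇ β)) ≡ k
  ∑ₛ-countᶠ {n} {zero} h = ∑ₛ-zero n
  ∑ₛ-countᶠ {k = suc k} h = begin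
    ∑ₛ (λ β → 𝟙 (h zero ≡ᵇ β) + countᶠ (λ i → h (suc i) ≡ᵇ β))
      ≡⟨ ∑ₛ-distrib-+ (λ β → 𝟙 (h zero ≡ᵇ β)) (λ β → countᶠ (λ i → h (suc i) ≡ᵇ β)) ⟩
    ∑ₛ (λ β → 𝟙 (h zero ≡ᵇ β)) + ∑ₛ (λ β → countᶠ (λ i → h (suc i) ≡ᵇ β))
      ≡⟨ cong₂ _+_ (∑ₛ-𝟙 (h zero)) (∑ₛ-countᶠ (h ∘ suc)) ⟩
    suc k ∎
    where open ≡-Reasoning

  ∑ₛ-cancel : ∀ {n} (f u : Subset n → ℕ) {x c} → ∑ₛ u ≡ x → ∑ₛ (λ S → f S + u S) ≡ x + c → ∑ₛ f ≡ c
  ∑ₛ-cancel f u {x} {c} ∑u≡x ∑f+u≡x+c = +-cancelʳ-≡ x (∑ₛ f) c (begin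
    ∑ₛ f + x             ≡⟨ cong (∑ₛ f +_) (sym ∑u≡x) ⟩
    ∑ₛ f + ∑ₛ u          ≡⟨ sym (∑ₛ-distrib-+ f u) ⟩
    ∑ₛ (λ S → f S + u S) ≡⟨ ∑f+u≡x+c ⟩
    x + c                ≡⟨ +-comm x c ⟩
    c + x                ∎)
    where open ≡-Reasoning

  RowSums : ∀ {n k} → (Subset n → Subset n → ℕ) → (Fin k → Subset n) → Set
  RowSums M f = ∀ α → ∑ₛ (M α) ≡ countᶠ (λ i → f i ≡ᵇ α)

  ColumnSums : ∀ {n k} → (Subset n → Subset n → ℕ) → (Fin k → Subset n) → Set
  ColumnSums M g = ∀ β → ∑ₛ (λ α → M α β) ≡ countᶠ (λ i → g i ≡ᵇ β)

  unit : ∀ {n} → Subset n → Subset n → Subset n → Subset n → ℕ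
  unit α₀ β₀ α β = 𝟙 (α₀ ≡ᵇ α) * 𝟙 (β₀ ≡ᵇ β)

  unit-row : ∀ {n} (α₀ β₀ α : Subset n) → ∑ₛ (unit α₀ β₀ α) ≡ 𝟙 (α₀ ≡ᵇ α)
  unit-row α₀ β₀ α =
    trans (∑ₛ-*ˡ (𝟙 (α₀ ≡ᵇ α)) (λ β → 𝟙 (β₀ ≡ᵇ β)))
          (trans (cong (𝟙 (α₀ ≡ᵇ α) *_) (∑ₛ-𝟙 β₀)) (*-identityʳ _))

  unit-column : ∀ {n} (α₀ β₀ β : Subset n) → ∑ₛ (λ α → unit α₀ β₀ α β) ≡ 𝟙 (β₀ ≡ᵇ β)
  unit-column α₀ β₀ β =
    trans (∑ₛ-*ʳ (𝟙 (β₀ ≡ᵇ β)) (λ α → 𝟙 (α₀ ≡ᵇ α)))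
          (trans (cong (_* 𝟙 (β₀ ≡ᵇ β)) (∑ₛ-𝟙 α₀)) (*-identityˡ _))

  decrement : ∀ {n} → (Subset n → Subset n → ℕ) → Subset n → Subset n → Subset n → Subset n → ℕ
  decrement M α₀ β₀ α β = M α β ∸ unit α₀ β₀ α β

  decrement-+-unit : ∀ {n} (M : Subset n → Subset n → ℕ) {α₀ β₀} → 0 < M α₀ β₀ →
                     ∀ α β → M α β ≡ decrement M α₀ β₀ α β + unit α₀ β₀ α β
  decrement-+-unit M {α₀} {β₀} pos α β = sym (m∸n+n≡m unit≤M)
    where
    unit≤M : unit α₀ β₀ α β ≤ M α β
    unit≤M with α₀ ≟ₛ α | β₀ ≟ₛ β
    ... | yes refl | yes refl = pos
    ... | yes _    | no _     = z≤n
    ... | no _     | _        = z≤n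

  rowSums-decrement : ∀ {n k} (f : Fin (suc k) → Subset n) (M : Subset n → Subset n → ℕ) {β₀} →
                      0 < M (f zero) β₀ → RowSums M f → RowSums (decrement M (f zero) β₀) (f ∘ suc)
  rowSums-decrement f M {β₀} pos rows α =
    ∑ₛ-cancel (decrement M (f zero) β₀ α) (unit (f zero) β₀ α) (unit-row (f zero) β₀ α)
      (trans (∑ₛ-cong (λ β → sym (decrement-+-unit M pos α β))) (rows α))

  columnSums-decrement : ∀ {n k} (g : Fin (suc k) → Subset n) (M : Subset n → Subset n → ℕ) {α₀ β₀ j} →
                         0 < M α₀ β₀ → g j ≡ β₀ → ColumnSums M g →
                         ColumnSums (decrement M α₀ β₀) (g ∘ punchIn j)
  columnSums-decrement g M {α₀} {β₀} {j} pos gj≡β₀ cols β =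
    ∑ₛ-cancel (λ α → decrement M α₀ β₀ α β) (λ α → unit α₀ β₀ α β) (unit-column α₀ β₀ β) (begin
      ∑ₛ (λ α → decrement M α₀ β₀ α β + unit α₀ β₀ α β) ≡⟨ ∑ₛ-cong (λ α → sym (decrement-+-unit M pos α β)) ⟩
      ∑ₛ (λ α → M α β)                                  ≡⟨ cols β ⟩
      countᶠ (λ i → g i ≡ᵇ β)                           ≡⟨ sum-remove {i = j} (λ i → 𝟙 (g i ≡ᵇ β)) ⟩
      𝟙 (g j ≡ᵇ β) + countᶠ (λ i → g (punchIn j i) ≡ᵇ β)
        ≡⟨ cong (λ γ → 𝟙 (γ ≡ᵇ β) + countᶠ (λ i → g (punchIn j i) ≡ᵇ β)) gj≡β₀ ⟩
      𝟙 (β₀ ≡ᵇ β) + countᶠ (λ i → g (punchIn j i) ≡ᵇ β) ∎)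
    where open ≡-Reasoning

  positive-entry : ∀ {n k} (f g : Fin (suc k) → Subset n) (M : Subset n → Subset n → ℕ) →
                   RowSums M f → ColumnSums M g → ∃[ β₀ ] ∃[ j ] 0 < M (f zero) β₀ × g j ≡ β₀
  positive-entry f g M rows cols = β₀ , j , entry-positive , ≡ᵇ⇒≡ (proj₂ g-class-β₀)
    where
    row-positive : 0 < ∑ₛ (M (f zero))
    row-positive rewrite rows (f zero) | ≡ᵇ-refl (f zero) = s≤s z≤n
    β₀ = proj₁ (∑ₛ-positive (M (f zero)) row-positive)
    entry-positive = proj₂ (∑ₛ-positive (M (f zero)) row-positive)
    column-positive : 0 < countᶠ (λ i → g i ≡ᵇ β₀)
    column-positive = ≤-trans entry-positive (≤-trans (∑ₛ-≤ (λ α → M α β₀) (f zero)) (≤-reflexive (cols β₀)))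
    g-class-β₀ = countᶠ-positive (λ i → g i ≡ᵇ β₀) column-positive
    j = proj₁ g-class-β₀

  -- Match i = 0 with some j whose class β₀ under g has a positive entry M (f 0) β₀,
  -- and recurse on the table with that entry decreased by one.
  realise : ∀ {n k} (f g : Fin k → Subset n) (M : Subset n → Subset n → ℕ) → RowSums M f → ColumnSums M g →
            Σ (Permutation′ k) λ σ → ∀ α β → countᶠ (λ i → f i ≡ᵇ α ∧ g (σ ⟨$⟩ʳ i) ≡ᵇ β) ≡ M α β
  realise {k = zero} f g M rows cols =
    Perm.id , λ α β → sym (n≤0⇒n≡0 (≤-trans (∑ₛ-≤ (M α) β) (≤-reflexive (rows α))))
  realise {k = suc k} f g M rows cols with positive-entry f g M rows cols
  ... | β₀ , j , pos , gj≡β₀ = σ , joint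
    where
    α₀ = f zero
    M′ = decrement M α₀ β₀
    realised = realise (f ∘ suc) (g ∘ punchIn j) M′
                 (rowSums-decrement f M pos rows) (columnSums-decrement g M pos gj≡β₀ cols)
    σ′ = proj₁ realised

    σ : Permutation′ (suc k)
    σ = Perm.insert zero j σ′

    joint : ∀ α β → countᶠ (λ i → f i ≡ᵇ α ∧ g (σ ⟨$⟩ʳ i) ≡ᵇ β) ≡ M α β
    joint α β = begin
      𝟙 (α₀ ≡ᵇ α ∧ g j ≡ᵇ β) + countᶠ (λ i → f (suc i) ≡ᵇ α ∧ g (σ ⟨$⟩ʳ suc i) ≡ᵇ β)
        ≡⟨ cong₂ _+_ (trans (𝟙-∧ (α₀ ≡ᵇ α) (g j ≡ᵇ β)) (cong (λ γ → 𝟙 (α₀ ≡ᵇ α) * 𝟙 (γ ≡ᵇ β)) gj≡β₀))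
                     (sum-cong-≗ (λ i → cong (λ x → 𝟙 (f (suc i) ≡ᵇ α ∧ g x ≡ᵇ β))
                                             (insert-punchIn zero j σ′ i))) ⟩
      unit α₀ β₀ α β + countᶠ (λ i → f (suc i) ≡ᵇ α ∧ g (punchIn j (σ′ ⟨$⟩ʳ i)) ≡ᵇ β)
        ≡⟨ cong (unit α₀ β₀ α β +_) (proj₂ realised α β) ⟩
      unit α₀ β₀ α β + M′ α β ≡⟨ +-comm (unit α₀ β₀ α β) (M′ α β) ⟩
      M′ α β + unit α₀ β₀ α β ≡⟨ decrement-+-unit M pos α β ⟨
      M α β                   ∎
      where open ≡-Reasoning

  -- The table a α · b β / k has margins a and b because a and b both sum to k.
  realise-proportional :
    ∀ {n k} .{{_ : NonZero k}} (f g : Fin k → Subset n) →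
    (∀ α β → k ∣ countᶠ (λ i → f i ≡ᵇ α) * countᶠ (λ i → g i ≡ᵇ β)) →
    Σ (Permutation′ k) λ σ → ∀ α β →
      countᶠ (λ i → f i ≡ᵇ α ∧ g (σ ⟨$⟩ʳ i) ≡ᵇ β) * k ≡ countᶠ (λ i → f i ≡ᵇ α) * countᶠ (λ i → g i ≡ᵇ β)
  realise-proportional {k = k} f g k∣ab = σ , λ α β →
    trans (cong (_* k) (proj₂ realised α β)) (sym (_∣_.equality (k∣ab α β)))
    where
    a b : Subset _ → ℕ
    a α = countᶠ (λ i → f i ≡ᵇ α)
    b β = countᶠ (λ i → g i ≡ᵇ β)

    M : Subset _ → Subset _ → ℕ
    M α β = quotient (k∣ab α β)

    M*k≡ab : ∀ α β → M α β * k ≡ a α * b β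
    M*k≡ab α β = sym (_∣_.equality (k∣ab α β))

    rows : RowSums M f
    rows α = *-cancelʳ-≡ (∑ₛ (M α)) (a α) k (begin
      ∑ₛ (M α) * k              ≡⟨ sym (∑ₛ-*ʳ k (M α)) ⟩
      ∑ₛ (λ β → M α β * k)      ≡⟨ ∑ₛ-cong (M*k≡ab α) ⟩
      ∑ₛ (λ β → a α * b β)      ≡⟨ ∑ₛ-*ˡ (a α) b ⟩
      a α * ∑ₛ b                ≡⟨ cong (a α *_) (∑ₛ-countᶠ g) ⟩
      a α * k                   ∎)
      where open ≡-Reasoning

    cols : ColumnSums M g
    cols β = *-cancelʳ-≡ (∑ₛ (λ α → M α β)) (b β) k (begin
      ∑ₛ (λ α → M α β) * k      ≡⟨ sym (∑ₛ-*ʳ k (λ α → M α β)) ⟩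
      ∑ₛ (λ α → M α β * k)      ≡⟨ ∑ₛ-cong (λ α → M*k≡ab α β) ⟩
      ∑ₛ (λ α → a α * b β)      ≡⟨ ∑ₛ-*ʳ (b β) a ⟩
      ∑ₛ a * b β                ≡⟨ cong (_* b β) (∑ₛ-countᶠ f) ⟩
      k * b β                   ≡⟨ *-comm k (b β) ⟩
      b β * k                   ∎)
      where open ≡-Reasoning

    realised = realise f g M rows cols
    σ = proj₁ realised

module Enumeration where
  open ℕΣ
  open import Data.List using (tabulate)
  open import Data.Nat using (_+_; _*_)
  open import Data.Nat.Properties using (+-assoc; +-0-commutativeMonoid)
  open import Algebra.Properties.CommutativeMonoid.Sum +-0-commutativeMonoid
    using (sum; sum-cong-≗)
  open Realisation using (countᶠ; realise-proportional)

  Copies′ : ∀ {n} → (Subset n → ℕ) → Set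
  Copies′ {n} c = Σ (Subset n) (λ T → Fin (c T))

  copies : ∀ {n} (c : Subset n → ℕ) → List (Copies′ c)
  copies {n} c = concatMap (λ T → map (T ,_) (allFin (c T))) (allSubsets n)

  count-++ : ∀ {A : Set} (p : A → Bool) xs ys → count p (xs ++ ys) ≡ count p xs + count p ys
  count-++ p [] ys = refl
  count-++ p (x ∷ xs) ys with p x
  ... | true = cong suc (count-++ p xs ys)
  ... | false = count-++ p xs ys

  count-concatMap : ∀ {A B : Set} (p : B → Bool) (F : A → List B) xs →
                    count p (concatMap F xs) ≡ foldr _+_ 0 (map (count p ∘ F) xs)
  count-concatMap p F [] = refl
  count-concatMap p F (x ∷ xs) = trans (count-++ p (F x) _) (cong (count p (F x) +_) (count-concatMap p F xs))

  count-tabulate : ∀ {A : Set} {k} (p : A → Bool) (f : Fin k → A) → count p (tabulate f) ≡ countᶠ (p ∘ f)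
  count-tabulate {k = zero} p f = refl
  count-tabulate {k = suc k} p f with p (f zero)
  ... | true = cong suc (count-tabulate p (f ∘ suc))
  ... | false = count-tabulate p (f ∘ suc)

  count-map : ∀ {A B : Set} (p : B → Bool) (f : A → B) xs → count p (map f xs) ≡ count (p ∘ f) xs
  count-map p f [] = refl
  count-map p f (x ∷ xs) with p (f x)
  ... | true = cong suc (count-map p f xs)
  ... | false = count-map p f xs

  count-copies : ∀ {n} (c : Subset n → ℕ) (p : Copies′ c → Bool) →
                 count p (copies c) ≡ ∑ₛ (λ T → countᶠ (λ i → p (T , i)))
  count-copies {n} c p = begin
    count p (copies c)
      ≡⟨ count-concatMap p (λ T → map (T ,_) (allFin (c T))) (allSubsets n) ⟩
    foldr _+_ 0 (map (λ T → count p (map (T ,_) (allFin (c T)))) (allSubsets n))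
      ≡⟨ cong (foldr _+_ 0) (map-cong (λ T → trans (count-map p (T ,_) (allFin (c T)))
                                                   (count-tabulate (λ i → p (T , i)) (λ i → i)))
                                     (allSubsets n)) ⟩
    foldr _+_ 0 (map (λ T → countᶠ (λ i → p (T , i))) (allSubsets n))
      ≡⟨ ∑ₛ-allSubsets n (λ T → countᶠ (λ i → p (T , i))) ⟩
    ∑ₛ (λ T → countᶠ (λ i → p (T , i))) ∎
    where open ≡-Reasoning

  extend : ∀ {n} {c : Subset (suc n) → ℕ} b → Copies′ (c ∘ (b ∷_)) → Copies′ c
  extend b (T , i) = b ∷ T , i

  index : ∀ {n} (c : Subset n → ℕ) → Copies′ c → Fin (∑ₛ c)
  index {zero} c ([] , i) = i
  index {suc n} c (true ∷ T , i) = index (c ∘ (true ∷_)) (T , i) ↑ˡ ∑ₛ (c ∘ (false ∷_))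
  index {suc n} c (false ∷ T , i) = ∑ₛ (c ∘ (true ∷_)) ↑ʳ index (c ∘ (false ∷_)) (T , i)

  element : ∀ {n} (c : Subset n → ℕ) → Fin (∑ₛ c) → Copies′ c
  element {zero} c i = [] , i
  element {suc n} c i =
    [ extend true ∘ element (c ∘ (true ∷_)) , extend false ∘ element (c ∘ (false ∷_)) ]′
      (splitAt (∑ₛ (c ∘ (true ∷_))) i)

  element-index : ∀ {n} (c : Subset n → ℕ) x → element c (index c x) ≡ x
  element-index {zero} c ([] , i) = refl
  element-index {suc n} c (true ∷ T , i)
    rewrite splitAt-↑ˡ (∑ₛ (c ∘ (true ∷_))) (index (c ∘ (true ∷_)) (T , i)) (∑ₛ (c ∘ (false ∷_)))
          | element-index (c ∘ (true ∷_)) (T , i) = refl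
  element-index {suc n} c (false ∷ T , i)
    rewrite splitAt-↑ʳ (∑ₛ (c ∘ (true ∷_))) (∑ₛ (c ∘ (false ∷_))) (index (c ∘ (false ∷_)) (T , i))
          | element-index (c ∘ (false ∷_)) (T , i) = refl

  splitAt⇒join : ∀ {a b} {i : Fin (a + b)} {x} → splitAt a i ≡ x → join a b x ≡ i
  splitAt⇒join {a} {b} {i} eq = trans (cong (join a b) (sym eq)) (join-splitAt a b i)

  index-element : ∀ {n} (c : Subset n → ℕ) i → index c (element c i) ≡ i
  index-element {zero} c i = refl
  index-element {suc n} c i with splitAt (∑ₛ (c ∘ (true ∷_))) i in eq
  ... | inj₁ i₁ = trans (cong (_↑ˡ ∑ₛ (c ∘ (false ∷_))) (index-element (c ∘ (true ∷_)) i₁)) (splitAt⇒join eq)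
  ... | inj₂ i₀ = trans (cong (∑ₛ (c ∘ (true ∷_)) ↑ʳ_) (index-element (c ∘ (false ∷_)) i₀)) (splitAt⇒join eq)

  sum-↑ : ∀ a b (h : Fin (a + b) → ℕ) → sum h ≡ sum (λ i → h (i ↑ˡ b)) + sum (λ i → h (a ↑ʳ i))
  sum-↑ zero b h = refl
  sum-↑ (suc a) b h = trans (cong (h zero +_) (sum-↑ a b (h ∘ suc))) (sym (+-assoc (h zero) _ _))

  ∑ₛ-countᶠ-element : ∀ {n} (c : Subset n → ℕ) (p : Copies′ c → Bool) →
                     ∑ₛ (λ T → countᶠ (λ i → p (T , i))) ≡ countᶠ (p ∘ element c)
  ∑ₛ-countᶠ-element {zero} c p = refl
  ∑ₛ-countᶠ-element {suc n} c p = begin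
    ∑ₛ (λ T → countᶠ (λ i → p (true ∷ T , i))) + ∑ₛ (λ T → countᶠ (λ i → p (false ∷ T , i)))
      ≡⟨ cong₂ _+_ (∑ₛ-countᶠ-element c₁ (p ∘ extend true)) (∑ₛ-countᶠ-element c₀ (p ∘ extend false)) ⟩
    countᶠ (p ∘ extend true ∘ element c₁) + countᶠ (p ∘ extend false ∘ element c₀)
      ≡⟨ cong₂ _+_ (sum-cong-≗ (λ i → cong (𝟙 ∘ p ∘ [ extend true ∘ element c₁ , extend false ∘ element c₀ ]′)
                                             (splitAt-↑ˡ (∑ₛ c₁) i (∑ₛ c₀))))
                   (sum-cong-≗ (λ i → cong (𝟙 ∘ p ∘ [ extend true ∘ element c₁ , extend false ∘ element c₀ ]′)
                                             (splitAt-↑ʳ (∑ₛ c₁) (∑ₛ c₀) i))) ⟨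
    sum (λ i → 𝟙 (p (element c (i ↑ˡ ∑ₛ c₀)))) + sum (λ i → 𝟙 (p (element c (∑ₛ c₁ ↑ʳ i))))
      ≡⟨ sum-↑ (∑ₛ c₁) (∑ₛ c₀) (𝟙 ∘ p ∘ element c) ⟨
    countᶠ (p ∘ element c) ∎
    where
    open ≡-Reasoning
    c₁ c₀ : Subset n → ℕ
    c₁ = c ∘ (true ∷_)
    c₀ = c ∘ (false ∷_)

  enumerate : ∀ {n} (c : Subset n → ℕ) {k} → ∑ₛ c ≡ k → Copies′ c ↔ Fin k
  enumerate c refl = mk↔ₛ′ (index c) (element c) (index-element c) (element-index c)

  count-enumerate : ∀ {n} (c : Subset n → ℕ) {k} (∑c≡k : ∑ₛ c ≡ k) (p : Copies′ c → Bool) →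
                    count p (copies c) ≡ countᶠ (p ∘ Inverse.from (enumerate c ∑c≡k))
  count-enumerate c refl p = trans (count-copies c p) (∑ₛ-countᶠ-element c p)

  realise-copies :
    ∀ {n k} .{{_ : NonZero k}} (cL cR : Subset n → ℕ) → ∑ₛ cL ≡ k → ∑ₛ cR ≡ k →
    (clL : Copies′ cL → Subset n) (clR : Copies′ cR → Subset n) →
    (∀ α β → k ∣ count (λ x → clL x ≡ᵇ α) (copies cL) * count (λ y → clR y ≡ᵇ β) (copies cR)) →
    Σ (Copies′ cL ⤖ Copies′ cR) λ ψ → ∀ α β →
      count (λ x → clL x ≡ᵇ α ∧ clR (Bijection.to ψ x) ≡ᵇ β) (copies cL) * k
      ≡ count (λ x → clL x ≡ᵇ α) (copies cL) * count (λ y → clR y ≡ᵇ β) (copies cR)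
  realise-copies {k = k} cL cR ∑cL≡k ∑cR≡k clL clR k∣ = ↔⇒⤖ ψ , joint
    where
    enumL = enumerate cL ∑cL≡k
    enumR = enumerate cR ∑cR≡k
    f g : Fin k → Subset _
    f = clL ∘ Inverse.from enumL
    g = clR ∘ Inverse.from enumR

    classesL : ∀ α → count (λ x → clL x ≡ᵇ α) (copies cL) ≡ countᶠ (λ i → f i ≡ᵇ α)
    classesL α = count-enumerate cL ∑cL≡k (λ x → clL x ≡ᵇ α)

    classesR : ∀ β → count (λ y → clR y ≡ᵇ β) (copies cR) ≡ countᶠ (λ i → g i ≡ᵇ β)
    classesR β = count-enumerate cR ∑cR≡k (λ y → clR y ≡ᵇ β)

    realised = realise-proportional f g (λ α β → subst (k ∣_) (cong₂ _*_ (classesL α) (classesR β)) (k∣ α β))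
    σ = proj₁ realised

    ψ : Copies′ cL ↔ Copies′ cR
    ψ = ↔-trans enumL (↔-trans σ (↔-sym enumR))

    joint : ∀ α β → count (λ x → clL x ≡ᵇ α ∧ clR (Inverse.to ψ x) ≡ᵇ β) (copies cL) * k
                    ≡ count (λ x → clL x ≡ᵇ α) (copies cL) * count (λ y → clR y ≡ᵇ β) (copies cR)
    joint α β = begin
      count (λ x → clL x ≡ᵇ α ∧ clR (Inverse.to ψ x) ≡ᵇ β) (copies cL) * k
        ≡⟨ cong (_* k) (count-enumerate cL ∑cL≡k _) ⟩
      countᶠ (λ i → f i ≡ᵇ α ∧ clR (Inverse.to ψ (Inverse.from enumL i)) ≡ᵇ β) * k
        ≡⟨ cong (_* k) (sum-cong-≗ (λ i → cong (λ j → 𝟙 (f i ≡ᵇ α ∧ g (σ ⟨$⟩ʳ j) ≡ᵇ β))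
                                                (Inverse.strictlyInverseˡ enumL i))) ⟩
      countᶠ (λ i → f i ≡ᵇ α ∧ g (σ ⟨$⟩ʳ i) ≡ᵇ β) * k
        ≡⟨ proj₂ realised α β ⟩
      countᶠ (λ i → f i ≡ᵇ α) * countᶠ (λ i → g i ≡ᵇ β)
        ≡⟨ cong₂ _*_ (classesL α) (classesR β) ⟨
      count (λ x → clL x ≡ᵇ α) (copies cL) * count (λ y → clR y ≡ᵇ β) (copies cR) ∎
      where open ≡-Reasoning

module Inversion where
  open ℤΣ
  open Realisation using (countᶠ; countᶠ-const)
  open Enumeration using (copies; count-copies)
  open import Data.Integer using (ℤ; +_; 0ℤ; 1ℤ; -1ℤ; ∣_∣; _+_; _*_; _≤_)
  open import Data.Integer.Properties
    using (*-identityˡ; *-zeroʳ; *-assoc; *-distribʳ-+; 0≤i⇒+∣i∣≡i; pos-+; +-injective)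
  open import Data.Integer.Tactic.RingSolver using (solve-∀)
  open import Data.Bool using (if_then_else_)
  open import Data.Bool.Properties using (∧-zeroʳ)
  import Data.Bool as Bool
  import Data.Nat as ℕ
  import Data.Nat.Properties as ℕ
  open import Data.Fin.Subset using (⊤; ⊥; _∩_; ∁; _⊆_; _∈_; _∉_)
  open import Data.Fin.Subset.Properties using (_⊆?_; p⊆q⇒∣p∣≤∣q∣; ∩-zeroʳ)
  open import Data.Vec using (here; there)
  import Data.Fin.Subset as Sub

  _⇒ᵇ_ : Bool → Bool → Bool
  true ⇒ᵇ t = t
  false ⇒ᵇ t = true

  ⊆?-∷ : ∀ {n} b t (B T : Subset n) → does ((b ∷ B) ⊆? (t ∷ T)) ≡ (b ⇒ᵇ t) ∧ does (B ⊆? T)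
  ⊆?-∷ true true B T = refl
  ⊆?-∷ true false B T = refl
  ⊆?-∷ false t B T = refl

  möbius : ∀ {n} → Subset n → Subset n → ℤ
  möbius T U = if does (T ⊆? U) ∧ does (U ⊆? ⊤) then sign (Sub.∣ U ∣ ℕ.∸ Sub.∣ T ∣) else 0ℤ

  altSum-möbius : ∀ {n} (f : Subset n → ℤ) T → altSum f T ⊤ ≡ ∑ₛ (λ U → möbius T U * f U)
  altSum-möbius {n} f T = trans (∑ₛ-allSubsets n _) (∑ₛ-cong pointwise)
    where
    pointwise : ∀ U → (if does (T ⊆? U) ∧ does (U ⊆? ⊤) then sign (Sub.∣ U ∣ ℕ.∸ Sub.∣ T ∣) * f U else + 0)
                      ≡ möbius T U * f U
    pointwise U with does (T ⊆? U) ∧ does (U ⊆? ⊤)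
    ... | true = refl
    ... | false = refl

  möbius₁ : Bool → Bool → ℤ
  möbius₁ true true = 1ℤ
  möbius₁ true false = 0ℤ
  möbius₁ false true = -1ℤ
  möbius₁ false false = 1ℤ

  möbius-∷ : ∀ {n} t u (T U : Subset n) → möbius (t ∷ T) (u ∷ U) ≡ möbius₁ t u * möbius T U
  möbius-∷ true true T U = sym (*-identityˡ _)
  möbius-∷ true false T U = refl
  möbius-∷ false false T U = sym (*-identityˡ _)
  möbius-∷ false true T U with T ⊆? U
  ... | no _ = refl
  ... | yes T⊆U with does (U ⊆? ⊤)
  ...   | false = refl
  ...   | true = cong sign (ℕ.+-∸-assoc 1 (p⊆q⇒∣p∣≤∣q∣ T⊆U))

  -- With D = ∁ B and E the externally active elements, T ∩ D ∩ E is the class of the copies of (B , T).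
  inClass : ∀ {n} (B D E α T : Subset n) → Bool
  inClass B D E α T = ((T ∩ D) ∩ E) ≡ᵇ α ∧ does (B ⊆? T)

  inClass₁ : (b d e a t : Bool) → Bool
  inClass₁ b d e a t = does (((t ∧ d) ∧ e) Bool.≟ a) ∧ (b ⇒ᵇ t)

  𝟙-∧-interchange : ∀ p q r s → 𝟙 ((p ∧ q) ∧ (r ∧ s)) ≡ 𝟙 (p ∧ r) * 𝟙 (q ∧ s)
  𝟙-∧-interchange true true true s = sym (*-identityˡ _)
  𝟙-∧-interchange true true false s = refl
  𝟙-∧-interchange true false true s = refl
  𝟙-∧-interchange true false false s = refl
  𝟙-∧-interchange false q r s = refl

  inClass-∷ : ∀ {n} b d e a t (B D E α T : Subset n) →
    𝟙 (inClass (b ∷ B) (d ∷ D) (e ∷ E) (a ∷ α) (t ∷ T)) ≡ 𝟙 (inClass₁ b d e a t) * 𝟙 (inClass B D E α T)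
  inClass-∷ b d e a t B D E α T =
    trans (cong (λ s → 𝟙 ((does (((t ∧ d) ∧ e) Bool.≟ a) ∧ ((T ∩ D) ∩ E) ≡ᵇ α) ∧ s)) (⊆?-∷ b t B T))
          (𝟙-∧-interchange (does (((t ∧ d) ∧ e) Bool.≟ a)) (((T ∩ D) ∩ E) ≡ᵇ α) (b ⇒ᵇ t) (does (B ⊆? T)))

  -- kernel B D E α U is the sum over the T ⊆ U in the class α of (-1)^(|U| - |T|), which
  -- factors over the coordinates (∑ₛ-inClass-möbius).
  kernel₁ : (b d e a u : Bool) → ℤ
  kernel₁ b d e a u = 𝟙 (inClass₁ b d e a true) * möbius₁ true u + 𝟙 (inClass₁ b d e a false) * möbius₁ false u

  kernel : ∀ {n} (B D E α U : Subset n) → ℤ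
  kernel [] [] [] [] [] = 1ℤ
  kernel (b ∷ B) (d ∷ D) (e ∷ E) (a ∷ α) (u ∷ U) = kernel₁ b d e a u * kernel B D E α U

  ∑ₛ-inClass-möbius : ∀ {n} (B D E α U : Subset n) →
                      ∑ₛ (λ T → 𝟙 (inClass B D E α T) * möbius T U) ≡ kernel B D E α U
  ∑ₛ-inClass-möbius [] [] [] [] [] = refl
  ∑ₛ-inClass-möbius (b ∷ B) (d ∷ D) (e ∷ E) (a ∷ α) (u ∷ U) = begin
    ∑ₛ (λ T → term true T) + ∑ₛ (λ T → term false T)
      ≡⟨ cong₂ _+_ (∑ₛ-cong (factor true)) (∑ₛ-cong (factor false)) ⟩
    ∑ₛ (λ T → local true * rest T) + ∑ₛ (λ T → local false * rest T)
      ≡⟨ cong₂ _+_ (∑ₛ-*ˡ (local true) rest) (∑ₛ-*ˡ (local false) rest) ⟩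
    local true * ∑ₛ rest + local false * ∑ₛ rest
      ≡⟨ cong (λ x → local true * x + local false * x) (∑ₛ-inClass-möbius B D E α U) ⟩
    local true * kernel B D E α U + local false * kernel B D E α U
      ≡⟨ *-distribʳ-+ (kernel B D E α U) (local true) (local false) ⟨
    kernel₁ b d e a u * kernel B D E α U ∎
    where
    open ≡-Reasoning
    term : Bool → Subset _ → ℤ
    term t T = 𝟙 (inClass (b ∷ B) (d ∷ D) (e ∷ E) (a ∷ α) (t ∷ T)) * möbius (t ∷ T) (u ∷ U)
    local : Bool → ℤ
    local t = 𝟙 (inClass₁ b d e a t) * möbius₁ t u
    rest : Subset _ → ℤ
    rest T = 𝟙 (inClass B D E α T) * möbius T U
    factor : ∀ t T → term t T ≡ local t * rest T
    factor t T = trans (cong₂ _*_ (inClass-∷ b d e a t B D E α T) (möbius-∷ t u T U))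
                       (interchange (𝟙 (inClass₁ b d e a t)) (𝟙 (inClass B D E α T)) (möbius₁ t u) (möbius T U))
      where
      interchange : ∀ x y z w → (x * y) * (z * w) ≡ (x * z) * (y * w)
      interchange = solve-∀

  +-∑ₛ : ∀ {n} (f : Subset n → ℕ) → + ℕΣ.∑ₛ f ≡ ∑ₛ (λ S → + f S)
  +-∑ₛ {zero} f = refl
  +-∑ₛ {suc n} f = trans (pos-+ (ℕΣ.∑ₛ (f ∘ (true ∷_))) (ℕΣ.∑ₛ (f ∘ (false ∷_))))
                         (cong₂ _+_ (+-∑ₛ (f ∘ (true ∷_))) (+-∑ₛ (f ∘ (false ∷_))))

  -- mult M B is multiplicity m B and dmult M B is multiplicity (m ∘ ∁) (∁ B).
  multiplicity : ∀ {n} (w : Subset n → ℕ) (B : Subset n) → Subset n → ℕ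
  multiplicity w B T = if does (B ⊆? T) then ∣ altSum (λ U → + w U) T ⊤ ∣ else 0

  count-classes :
    ∀ {n} (w : Subset n → ℕ) (B D E α : Subset n) →
    (∀ T → B ⊆ T → 0ℤ ≤ altSum (λ U → + w U) T ⊤) →
    + count (λ x → ((proj₁ x ∩ D) ∩ E) ≡ᵇ α) (copies (multiplicity w B))
    ≡ ∑ₛ (λ U → kernel B D E α U * + w U)
  count-classes {n} w B D E α μ≥0 = begin
    + count (λ x → inα (proj₁ x)) (copies c)
      ≡⟨ cong +_ (trans (count-copies c (λ x → inα (proj₁ x))) (ℕΣ.∑ₛ-cong (λ T → countᶠ-const (c T) (inα T)))) ⟩
    + ℕΣ.∑ₛ (λ T → ℕΣ.𝟙 (inα T) ℕ.* c T)
      ≡⟨ +-∑ₛ (λ T → ℕΣ.𝟙 (inα T) ℕ.* c T) ⟩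
    ∑ₛ (λ T → + (ℕΣ.𝟙 (inα T) ℕ.* c T))
      ≡⟨ ∑ₛ-cong pointwise ⟩
    ∑ₛ (λ T → 𝟙 (inClass B D E α T) * ∑ₛ (λ U → möbius T U * + w U))
      ≡⟨ ∑ₛ-cong (λ T → ∑ₛ-*ˡ (𝟙 (inClass B D E α T)) (λ U → möbius T U * + w U)) ⟨
    ∑ₛ (λ T → ∑ₛ (λ U → 𝟙 (inClass B D E α T) * (möbius T U * + w U)))
      ≡⟨ ∑ₛ-comm (λ T U → 𝟙 (inClass B D E α T) * (möbius T U * + w U)) ⟩
    ∑ₛ (λ U → ∑ₛ (λ T → 𝟙 (inClass B D E α T) * (möbius T U * + w U)))
      ≡⟨ ∑ₛ-cong (λ U → trans (∑ₛ-cong (λ T → sym (*-assoc (𝟙 (inClass B D E α T)) (möbius T U) (+ w U))))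
                              (∑ₛ-*ʳ (+ w U) (λ T → 𝟙 (inClass B D E α T) * möbius T U))) ⟩
    ∑ₛ (λ U → ∑ₛ (λ T → 𝟙 (inClass B D E α T) * möbius T U) * + w U)
      ≡⟨ ∑ₛ-cong (λ U → cong (_* + w U) (∑ₛ-inClass-möbius B D E α U)) ⟩
    ∑ₛ (λ U → kernel B D E α U * + w U) ∎
    where
    open ≡-Reasoning
    c = multiplicity w B
    inα : Subset n → Bool
    inα T = ((T ∩ D) ∩ E) ≡ᵇ α
    pointwise : ∀ T → + (ℕΣ.𝟙 (inα T) ℕ.* c T) ≡ 𝟙 (inClass B D E α T) * ∑ₛ (λ U → möbius T U * + w U)
    pointwise T with inα T | B ⊆? T
    ... | false | _ = refl
    ... | true | no _ = refl
    ... | true | yes B⊆T = begin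
      + (∣ altSum (λ U → + w U) T ⊤ ∣ ℕ.+ 0) ≡⟨ cong +_ (ℕ.+-identityʳ _) ⟩
      + ∣ altSum (λ U → + w U) T ⊤ ∣        ≡⟨ 0≤i⇒+∣i∣≡i (μ≥0 T B⊆T) ⟩
      altSum (λ U → + w U) T ⊤              ≡⟨ altSum-möbius (λ U → + w U) T ⟩
      ∑ₛ (λ U → möbius T U * + w U)         ≡⟨ *-identityˡ _ ⟨
      1ℤ * ∑ₛ (λ U → möbius T U * + w U)    ∎

  kernel₁-∉U : ∀ d e a → kernel₁ true d e a false ≡ 0ℤ
  kernel₁-∉U d e a = cong₂ _+_ (*-zeroʳ (𝟙 (inClass₁ true d e a true)))
                               (cong (λ b → 𝟙 b * 1ℤ) (∧-zeroʳ (does (((false ∧ d) ∧ e) Bool.≟ a))))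

  kernel₁-inactive : ∀ a → kernel₁ false true false a true ≡ 0ℤ
  kernel₁-inactive true = refl
  kernel₁-inactive false = refl

  kernel₁-diagonal : ∀ b u → kernel₁ b (not b) false false u ≡ 𝟙 (does (b Bool.≟ u))
  kernel₁-diagonal true true = refl
  kernel₁-diagonal true false = refl
  kernel₁-diagonal false true = refl
  kernel₁-diagonal false false = refl

  kernel-diagonal : ∀ {n} (B U : Subset n) → kernel B (∁ B) ⊥ ⊥ U ≡ 𝟙 (B ≡ᵇ U)
  kernel-diagonal [] [] = refl
  kernel-diagonal (b ∷ B) (u ∷ U) =
    trans (cong₂ _*_ (kernel₁-diagonal b u) (kernel-diagonal B U)) (sym (𝟙-∧ (does (b Bool.≟ u)) (B ≡ᵇ U)))

  private
    kernel-tail : ∀ {n} b d e a u (B D E α U : Subset n) →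
                  kernel (b ∷ B) (d ∷ D) (e ∷ E) (a ∷ α) (u ∷ U) ≢ 0ℤ → kernel B D E α U ≢ 0ℤ
    kernel-tail b d e a u B D E α U nz k≡0 =
      nz (trans (cong (kernel₁ b d e a u *_) k≡0) (*-zeroʳ (kernel₁ b d e a u)))

  kernel≢0⇒⊆ : ∀ {n} (B D E α U : Subset n) → kernel B D E α U ≢ 0ℤ → B ⊆ U
  kernel≢0⇒⊆ (true ∷ B) (d ∷ D) (e ∷ E) (a ∷ α) (false ∷ U) nz here =
    ⊥-elim (nz (cong (_* kernel B D E α U) (kernel₁-∉U d e a)))
  kernel≢0⇒⊆ (true ∷ B) (d ∷ D) (e ∷ E) (a ∷ α) (true ∷ U) nz here = here
  kernel≢0⇒⊆ (b ∷ B) (d ∷ D) (e ∷ E) (a ∷ α) (u ∷ U) nz (there x∈B) =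
    there (kernel≢0⇒⊆ B D E α U (kernel-tail b d e a u B D E α U nz) x∈B)

  kernel≢0⇒⊆E : ∀ {n} (B D E α U : Subset n) → kernel B D E α U ≢ 0ℤ →
                ∀ {x} → x ∈ U → x ∉ B → x ∈ D → x ∈ E
  kernel≢0⇒⊆E (true ∷ B) D E α U nz here x∉B x∈D = ⊥-elim (x∉B here)
  kernel≢0⇒⊆E (false ∷ B) (true ∷ D) (true ∷ E) (a ∷ α) (true ∷ U) nz here x∉B here = here
  kernel≢0⇒⊆E (false ∷ B) (true ∷ D) (false ∷ E) (a ∷ α) (true ∷ U) nz here x∉B here =
    ⊥-elim (nz (cong (_* kernel B D E α U) (kernel₁-inactive a)))
  kernel≢0⇒⊆E (b ∷ B) (d ∷ D) (e ∷ E) (a ∷ α) (u ∷ U) nz (there x∈U) x∉B (there x∈D) =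
    there (kernel≢0⇒⊆E B D E α U (kernel-tail b d e a u B D E α U nz) x∈U (x∉B ∘ there) x∈D)

  ∑ₛ-multiplicity : ∀ {n} (w : Subset n → ℕ) (B : Subset n) →
                    (∀ T → B ⊆ T → 0ℤ ≤ altSum (λ U → + w U) T ⊤) →
                    ℕΣ.∑ₛ (multiplicity w B) ≡ w B
  ∑ₛ-multiplicity {n} w B μ≥0 = +-injective (begin
    + ℕΣ.∑ₛ (multiplicity w B)
      ≡⟨ cong +_ (trans (count-copies c (inClass⊥ ∘ proj₁)) (ℕΣ.∑ₛ-cong everyCopy)) ⟨
    + count (λ x → ((proj₁ x ∩ ∁ B) ∩ ⊥) ≡ᵇ ⊥) (copies c)
      ≡⟨ count-classes w B (∁ B) ⊥ ⊥ μ≥0 ⟩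
    ∑ₛ (λ U → kernel B (∁ B) ⊥ ⊥ U * + w U)
      ≡⟨ ∑ₛ-cong (λ U → cong (_* + w U) (kernel-diagonal B U)) ⟩
    ∑ₛ (λ U → 𝟙 (B ≡ᵇ U) * + w U)
      ≡⟨ ∑ₛ-indicator B (λ U → + w U) ⟩
    + w B ∎)
    where
    open ≡-Reasoning
    c = multiplicity w B
    inClass⊥ : Subset n → Bool
    inClass⊥ T = ((T ∩ ∁ B) ∩ ⊥) ≡ᵇ ⊥
    everyCopy : ∀ T → countᶠ {c T} (λ _ → inClass⊥ T) ≡ c T
    everyCopy T = begin
      countᶠ {c T} (λ _ → inClass⊥ T) ≡⟨ countᶠ-const (c T) (inClass⊥ T) ⟩
      ℕΣ.𝟙 (inClass⊥ T) ℕ.* c T       ≡⟨ cong (λ b → ℕΣ.𝟙 b ℕ.* c T) inClass⊥≡true ⟩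
      1 ℕ.* c T                       ≡⟨ ℕ.*-identityˡ (c T) ⟩
      c T                             ∎
      where
      inClass⊥≡true : inClass⊥ T ≡ true
      inClass⊥≡true = trans (cong (_≡ᵇ ⊥) (∩-zeroʳ (T ∩ ∁ B))) (≡ᵇ-refl (⊥ {n = n}))

module MatroidFacts {n} (M : ArithmeticMatroid n) where
  open ArithmeticMatroid M
  open SubsetFacts
  open import Data.Nat using (_+_; _*_; _∸_; _≤_; _<_; _≟_)
  open import Data.Nat.Properties
    using (≤-trans; ≤-reflexive; ≤-antisym; ≤∧≢⇒<; m≤m+n; m≤n+m; +-comm; *-comm; +-monoʳ-≤; +-mono-≤;
           +-cancelʳ-≤; +-∸-assoc; <-irrefl; n<1+n; module ≤-Reasoning)
  import Data.Fin as Fin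
  import Data.Fin.Properties as Fin
  open import Data.Fin.Subset using (⊤; ⊥; ⁅_⁆; _∪_; _∩_; ∁; _⊆_; _∈_; _∉_; ∣_∣)
  open import Data.Fin.Subset.Properties
    using (_∈?_; ∣⁅x⁆∣≡1; x∈⁅x⁆; x∈⁅y⁆⇒x≡y; p⊆p∪q; q⊆p∪q; x∈p∪q⁻; p∩q⊆p; p∩q⊆q; x∈p∩q⁺;
           x∈p∩q⁻; x∉p⇒x∈∁p; x∈∁p⇒x∉p; x∉∁p⇒x∈p; x∈p⇒x∉∁p; ⊆-refl;
           ∪-identityʳ; ∪-assoc; ∪-comm; ∩-assoc; ∩-identityˡ; ∣⊤∣≡n)
  open import Data.Bool.Properties using (∧-conicalˡ; ∧-conicalʳ)

  Spans : Subset n → Fin n → Set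
  Spans S e = rk (S ∪ ⁅ e ⁆) ≡ rk S

  rk-∪ : ∀ A C → rk (A ∪ C) ≤ rk A + rk C
  rk-∪ A C = ≤-trans (m≤m+n (rk (A ∪ C)) (rk (A ∩ C))) (rk-submod A C)

  rk-∪⁅⁆ : ∀ S v → rk (S ∪ ⁅ v ⁆) ≤ suc (rk S)
  rk-∪⁅⁆ S v = begin
    rk (S ∪ ⁅ v ⁆)   ≤⟨ rk-∪ S ⁅ v ⁆ ⟩
    rk S + rk ⁅ v ⁆  ≤⟨ +-monoʳ-≤ (rk S) (rk-≤card ⁅ v ⁆) ⟩
    rk S + ∣ ⁅ v ⁆ ∣ ≡⟨ cong (rk S +_) (∣⁅x⁆∣≡1 v) ⟩
    rk S + 1         ≡⟨ +-comm (rk S) 1 ⟩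
    suc (rk S)       ∎
    where open ≤-Reasoning

  spans-mono : ∀ {Z A e} → Z ⊆ A → Spans Z e → Spans A e
  spans-mono {Z} {A} {e} Z⊆A Z-spans = ≤-antisym upper (rk-mono A (A ∪ ⁅ e ⁆) (p⊆p∪q ⁅ e ⁆))
    where
    A∪e⊆ : A ∪ ⁅ e ⁆ ⊆ (Z ∪ ⁅ e ⁆) ∪ A
    A∪e⊆ x∈ = [ q⊆p∪q (Z ∪ ⁅ e ⁆) A , p⊆p∪q A ∘ q⊆p∪q Z ⁅ e ⁆ ]′ (x∈p∪q⁻ A ⁅ e ⁆ x∈)
    upper : rk (A ∪ ⁅ e ⁆) ≤ rk A
    upper = +-cancelʳ-≤ (rk Z) (rk (A ∪ ⁅ e ⁆)) (rk A) (begin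
      rk (A ∪ ⁅ e ⁆) + rk Z
        ≤⟨ +-mono-≤ (rk-mono _ _ A∪e⊆) (rk-mono _ _ (λ z → x∈p∩q⁺ (p⊆p∪q ⁅ e ⁆ z , Z⊆A z))) ⟩
      rk ((Z ∪ ⁅ e ⁆) ∪ A) + rk ((Z ∪ ⁅ e ⁆) ∩ A) ≤⟨ rk-submod (Z ∪ ⁅ e ⁆) A ⟩
      rk (Z ∪ ⁅ e ⁆) + rk A                       ≡⟨ cong (_+ rk A) Z-spans ⟩
      rk Z + rk A                                 ≡⟨ +-comm (rk Z) (rk A) ⟩
      rk A + rk Z                                 ∎)
      where open ≤-Reasoning

  spans-∪ : ∀ S R → (∀ {e} → e ∈ R → Spans S e) → rk (S ∪ R) ≡ rk S
  spans-∪ S R spanned = subset-induction P base step R ⊆-refl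
    where
    P : Subset n → Set
    P R′ = R′ ⊆ R → rk (S ∪ R′) ≡ rk S
    base : P ⊥
    base _ = cong rk (∪-identityʳ S)
    step : ∀ R′ d → d ∉ R′ → P R′ → P (R′ ∪ ⁅ d ⁆)
    step R′ d _ ih R′∪d⊆R = begin
      rk (S ∪ (R′ ∪ ⁅ d ⁆)) ≡⟨ cong rk (∪-assoc S R′ ⁅ d ⁆) ⟨
      rk ((S ∪ R′) ∪ ⁅ d ⁆) ≡⟨ spans-mono (p⊆p∪q R′) (spanned (R′∪d⊆R (q⊆p∪q R′ ⁅ d ⁆ (x∈⁅x⁆ d)))) ⟩
      rk (S ∪ R′)           ≡⟨ ih (R′∪d⊆R ∘ p⊆p∪q ⁅ d ⁆) ⟩
      rk S                  ∎
      where open ≡-Reasoning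

  exchange : ∀ {Z e d} → ¬ Spans Z e → Spans (Z ∪ ⁅ d ⁆) e → Spans (Z ∪ ⁅ e ⁆) d
  exchange {Z} {e} {d} ¬Z-spans Zd-spans = ≤-antisym (begin
      rk ((Z ∪ ⁅ e ⁆) ∪ ⁅ d ⁆) ≡⟨ cong rk swap ⟩
      rk ((Z ∪ ⁅ d ⁆) ∪ ⁅ e ⁆) ≡⟨ Zd-spans ⟩
      rk (Z ∪ ⁅ d ⁆)           ≤⟨ rk-∪⁅⁆ Z d ⟩
      suc (rk Z)               ≡⟨ Ze-grows ⟨
      rk (Z ∪ ⁅ e ⁆)           ∎)
    (rk-mono _ _ (p⊆p∪q ⁅ d ⁆))
    where
    open ≤-Reasoning
    swap : (Z ∪ ⁅ e ⁆) ∪ ⁅ d ⁆ ≡ (Z ∪ ⁅ d ⁆) ∪ ⁅ e ⁆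
    swap = trans (∪-assoc Z ⁅ e ⁆ ⁅ d ⁆) (trans (cong (Z ∪_) (∪-comm ⁅ e ⁆ ⁅ d ⁆)) (sym (∪-assoc Z ⁅ d ⁆ ⁅ e ⁆)))
    Ze-grows : rk (Z ∪ ⁅ e ⁆) ≡ suc (rk Z)
    Ze-grows = ≤-antisym (rk-∪⁅⁆ Z e) (≤∧≢⇒< (rk-mono Z (Z ∪ ⁅ e ⁆) (p⊆p∪q ⁅ e ⁆)) (¬Z-spans ∘ sym))

  module Basis (B : Subset n) (isBasis : IsBasis M B) where

    E I : Subset n
    E = activeSet M B
    I = dualActiveSet M B

    rk-independent : ∀ {S} → S ⊆ B → rk S ≡ ∣ S ∣
    rk-independent {S} S⊆B = ≤-antisym (rk-≤card S) (+-cancelʳ-≤ ∣ B ∩ ∁ S ∣ ∣ S ∣ (rk S) (begin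
      ∣ S ∣ + ∣ B ∩ ∁ S ∣       ≡⟨ cong (λ X → ∣ X ∣ + ∣ B ∩ ∁ S ∣) (⊆⇒∩≡ S⊆B) ⟨
      ∣ B ∩ S ∣ + ∣ B ∩ ∁ S ∣   ≡⟨ ∣∩∣+∣∩∁∣ B S ⟩
      ∣ B ∣                      ≡⟨ proj₁ isBasis ⟩
      rk B                       ≡⟨ cong rk (∩∪∩∁ B S) ⟨
      rk ((B ∩ S) ∪ (B ∩ ∁ S))  ≤⟨ rk-∪ (B ∩ S) (B ∩ ∁ S) ⟩
      rk (B ∩ S) + rk (B ∩ ∁ S) ≤⟨ +-mono-≤ (≤-reflexive (cong rk (⊆⇒∩≡ S⊆B))) (rk-≤card (B ∩ ∁ S)) ⟩
      rk S + ∣ B ∩ ∁ S ∣        ∎))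
      where open ≤-Reasoning

    rk*-cobasis : ∀ T → ∁ T ⊆ B → rk* T ≡ n ∸ rk ⊤
    rk*-cobasis T ∁T⊆B = cong (_∸ rk ⊤) (begin
      ∣ T ∣ + rk (∁ T)         ≡⟨ cong (∣ T ∣ +_) (rk-independent ∁T⊆B) ⟩
      ∣ T ∣ + ∣ ∁ T ∣          ≡⟨ cong₂ (λ X Y → ∣ X ∣ + ∣ Y ∣) (∩-identityˡ T) (∩-identityˡ (∁ T)) ⟨
      ∣ ⊤ ∩ T ∣ + ∣ ⊤ ∩ ∁ T ∣  ≡⟨ ∣∩∣+∣∩∁∣ (⊤ {n = n}) T ⟩
      ∣ ⊤ {n = n} ∣            ≡⟨ ∣⊤∣≡n n ⟩
      n                        ∎)
      where open ≡-Reasoning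

    above⁻ : ∀ {v C x} → x ∈ above M v C → x ∈ C × v Fin.< x
    above⁻ {v} {C} {x} x∈ =
      proj₁ (x∈p∩q⁻ C _ x∈) , does⇒ (v Fin.<? x) (∈tabulate⁻ (proj₂ (x∈p∩q⁻ C _ x∈)))

    active⁻ : ∀ {e} → e ∈ E → e ∉ B × Spans (above M e B) e
    active⁻ {e} e∈E =
      not-does⇒ (e ∈? B) (∧-conicalˡ _ _ (∈tabulate⁻ e∈E)) ,
      does⇒ (rk (above M e B ∪ ⁅ e ⁆) ≟ rk (above M e B)) (∧-conicalʳ _ _ (∈tabulate⁻ e∈E))

    dualActive⁻ : ∀ {d} → d ∈ I → d ∈ B × rk* (above M d (∁ B) ∪ ⁅ d ⁆) ≡ rk* (above M d (∁ B))
    dualActive⁻ {d} d∈I =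
      does⇒ (d ∈? B) (∧-conicalˡ _ _ (∈tabulate⁻ d∈I)) ,
      does⇒ (rk* (above M d (∁ B) ∪ ⁅ d ⁆) ≟ rk* (above M d (∁ B))) (∧-conicalʳ _ _ (∈tabulate⁻ d∈I))

    -- Dual external activity of d says that d is a coloop of the elements outside
    -- C′ = {w ∉ B : w > d}.
    dualActive⇒coloop : ∀ {d} → d ∈ I → ¬ Spans (∁ (above M d (∁ B) ∪ ⁅ d ⁆)) d
    dualActive⇒coloop {d} d∈I W-spans = <-irrefl (sym grows) (n<1+n ((∣ C′ ∣ + rk W) ∸ rk ⊤))
      where
      C′ = above M d (∁ B)
      W = ∁ (C′ ∪ ⁅ d ⁆)
      d∈B = proj₁ (dualActive⁻ d∈I)

      C′⊆∁B : C′ ⊆ ∁ B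
      C′⊆∁B = proj₁ ∘ above⁻

      d∉C′ : d ∉ C′
      d∉C′ d∈C′ = x∈∁p⇒x∉p (C′⊆∁B d∈C′) d∈B

      rk∁C′≡rkW : rk (∁ C′) ≡ rk W
      rk∁C′≡rkW = trans (cong rk (sym (∁[p∪⁅x⁆]∪⁅x⁆≡∁p d∉C′))) W-spans

      r≤ : rk ⊤ ≤ ∣ C′ ∣ + rk W
      r≤ = begin
        rk ⊤         ≡⟨ proj₂ isBasis ⟨
        rk B         ≤⟨ rk-mono B (∁ C′) (λ x∈B → x∉p⇒x∈∁p (λ x∈C′ → x∈∁p⇒x∉p (C′⊆∁B x∈C′) x∈B)) ⟩
        rk (∁ C′)    ≡⟨ rk∁C′≡rkW ⟩
        rk W         ≤⟨ m≤n+m (rk W) ∣ C′ ∣ ⟩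
        ∣ C′ ∣ + rk W ∎
        where open ≤-Reasoning

      grows : suc ((∣ C′ ∣ + rk W) ∸ rk ⊤) ≡ (∣ C′ ∣ + rk W) ∸ rk ⊤
      grows = begin
        suc ((∣ C′ ∣ + rk W) ∸ rk ⊤)      ≡⟨ +-∸-assoc 1 r≤ ⟨
        (suc ∣ C′ ∣ + rk W) ∸ rk ⊤        ≡⟨ cong (λ k → (k + rk W) ∸ rk ⊤) (∣∪⁅⁆∣ d∉C′) ⟨
        rk* (C′ ∪ ⁅ d ⁆)                  ≡⟨ proj₂ (dualActive⁻ d∈I) ⟩
        rk* C′                            ≡⟨ cong (λ k → (∣ C′ ∣ + k) ∸ rk ⊤) rk∁C′≡rkW ⟩
        (∣ C′ ∣ + rk W) ∸ rk ⊤            ∎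
        where open ≡-Reasoning

    -- Otherwise exchange makes d spanned by Z ∪ {e}, which avoids C′ ∪ {d}, against dualActive⇒coloop.
    spans-without-dualActive : ∀ {Z d e} → Z ⊆ B → d ∉ Z → d ∈ I → e ∉ B → e Fin.< d →
                               Spans (Z ∪ ⁅ d ⁆) e → Spans Z e
    spans-without-dualActive {Z} {d} {e} Z⊆B d∉Z d∈I e∉B e<d Zd-spans with rk (Z ∪ ⁅ e ⁆) ≟ rk Z
    ... | yes Z-spans = Z-spans
    ... | no ¬Z-spans = ⊥-elim (dualActive⇒coloop d∈I (spans-mono Ze⊆W (exchange ¬Z-spans Zd-spans)))
      where
      C′ = above M d (∁ B)
      d∈B = proj₁ (dualActive⁻ d∈I)
      Ze⊆W : Z ∪ ⁅ e ⁆ ⊆ ∁ (C′ ∪ ⁅ d ⁆)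
      Ze⊆W x∈ = x∉p⇒x∈∁p ([ outside-Z , outside-e ]′ (x∈p∪q⁻ Z ⁅ e ⁆ x∈))
        where
        outside-Z : ∀ {x} → x ∈ Z → x ∉ C′ ∪ ⁅ d ⁆
        outside-Z x∈Z x∈ = [ (λ x∈C′ → x∈∁p⇒x∉p (proj₁ (above⁻ x∈C′)) (Z⊆B x∈Z))
                           , (λ x∈d → d∉Z (subst (_∈ Z) (x∈⁅y⁆⇒x≡y d x∈d) x∈Z)) ]′ (x∈p∪q⁻ C′ ⁅ d ⁆ x∈)
        outside-e : ∀ {x} → x ∈ ⁅ e ⁆ → x ∉ C′ ∪ ⁅ d ⁆
        outside-e x∈e x∈ rewrite x∈⁅y⁆⇒x≡y e x∈e =
          [ (λ e∈C′ → Fin.<-asym e<d (proj₂ (above⁻ e∈C′)))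
          , (λ e∈d → e∉B (subst (_∈ B) (sym (x∈⁅y⁆⇒x≡y d e∈d)) d∈B)) ]′ (x∈p∪q⁻ C′ ⁅ d ⁆ x∈)

    -- Remove the elements of B above e and outside A one at a time: each of them is
    -- dually active, so e stays spanned.
    active⇒spanned : ∀ {A e} → A ⊆ B → (∀ {d} → d ∈ B → d ∉ A → d ∈ I) → e ∈ E → Spans A e
    active⇒spanned {A} {e} A⊆B dualActive e∈E = spans-mono (p∩∁[p∩∁q]⊆q Be A) (removal (Be ∩ ∁ A) ⊆-refl)
      where
      Be = above M e B
      e∉B = proj₁ (active⁻ e∈E)

      P : Subset n → Set
      P R = R ⊆ Be ∩ ∁ A → Spans (Be ∩ ∁ R) e

      base : P ⊥
      base _ = subst (λ X → Spans X e) (sym (p∩∁⊥≡p Be)) (proj₂ (active⁻ e∈E))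

      step : ∀ R d → d ∉ R → P R → P (R ∪ ⁅ d ⁆)
      step R d _ ih R∪d⊆ = spans-without-dualActive Z⊆B d∉Z d∈I e∉B e<d
                             (spans-mono Be∖R⊆Z∪d (ih (R∪d⊆ ∘ p⊆p∪q ⁅ d ⁆)))
        where
        Z = Be ∩ ∁ (R ∪ ⁅ d ⁆)
        d∈Be∖A = R∪d⊆ (q⊆p∪q R ⁅ d ⁆ (x∈⁅x⁆ d))
        d∈B = proj₁ (above⁻ (p∩q⊆p Be (∁ A) d∈Be∖A))
        e<d = proj₂ (above⁻ (p∩q⊆p Be (∁ A) d∈Be∖A))
        d∈I = dualActive d∈B (x∈∁p⇒x∉p (p∩q⊆q Be (∁ A) d∈Be∖A))
        Z⊆B : Z ⊆ B
        Z⊆B = proj₁ ∘ above⁻ ∘ p∩q⊆p Be _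
        d∉Z : d ∉ Z
        d∉Z d∈Z = x∈∁p⇒x∉p (p∩q⊆q Be _ d∈Z) (q⊆p∪q R ⁅ d ⁆ (x∈⁅x⁆ d))
        Be∖R⊆Z∪d : Be ∩ ∁ R ⊆ Z ∪ ⁅ d ⁆
        Be∖R⊆Z∪d {x} x∈ with x Fin.≟ d
        ... | yes refl = q⊆p∪q Z ⁅ d ⁆ (x∈⁅x⁆ d)
        ... | no x≢d = p⊆p∪q ⁅ d ⁆ (x∈p∩q⁺ (p∩q⊆p Be _ x∈ , x∉p⇒x∈∁p (λ x∈R∪d →
                         [ x∈∁p⇒x∉p (p∩q⊆q Be _ x∈) , x≢d ∘ x∈⁅y⁆⇒x≡y d ]′ (x∈p∪q⁻ R ⁅ d ⁆ x∈R∪d))))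

      removal : ∀ R → P R
      removal = subset-induction P base step

    rk-spanned : ∀ {A C} → A ⊆ B → (∀ {d} → d ∈ B → d ∉ A → d ∈ I) →
                 A ⊆ C → (∀ {e} → e ∈ C → e ∉ B → e ∈ E) → rk C ≡ ∣ C ∩ B ∣
    rk-spanned {A} {C} A⊆B dualActive A⊆C C∖B⊆E = begin
      rk C                     ≡⟨ cong rk (∩∪∩∁ C B) ⟨
      rk ((C ∩ B) ∪ (C ∩ ∁ B)) ≡⟨ spans-∪ (C ∩ B) (C ∩ ∁ B) spanned ⟩
      rk (C ∩ B)               ≡⟨ rk-independent (p∩q⊆q C B) ⟩
      ∣ C ∩ B ∣                ∎
      where
      open ≡-Reasoning
      spanned : ∀ {e} → e ∈ C ∩ ∁ B → Spans (C ∩ B) e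
      spanned e∈ = spans-mono (λ a∈A → x∈p∩q⁺ (A⊆C a∈A , A⊆B a∈A))
                     (active⇒spanned A⊆B dualActive (C∖B⊆E (p∩q⊆p C _ e∈) (x∈∁p⇒x∉p (p∩q⊆q C _ e∈))))

    -- Axiom (3) with A = ∁ V, F = B ∩ V, T = U ∖ B, whose union is U.
    m-exchange : ∀ {U V} → B ⊆ U → (∀ {x} → x ∈ U → x ∉ B → x ∈ ∁ B → x ∈ E) →
                 ∁ B ⊆ V → (∀ {x} → x ∈ V → x ∉ ∁ B → x ∈ B → x ∈ I) →
                 m U * m (∁ V) ≡ m B * m (∁ V ∪ (U ∩ ∁ B))
    m-exchange {U} {V} B⊆U U∖B⊆E ∁B⊆V V∩B⊆I = begin
      m U * m (∁ V)                                 ≡⟨ *-comm (m U) (m (∁ V)) ⟩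
      m (∁ V) * m U                                 ≡⟨ cong (λ X → m (∁ V) * m X) A∪F∪T≡U ⟨
      m (∁ V) * m ((∁ V ∪ (B ∩ V)) ∪ (U ∩ ∁ B))     ≡⟨ ax3 (∁ V) (B ∩ V) (U ∩ ∁ B) A∩F≡⊥ A∩T≡⊥ F∩T≡⊥ rank ⟩
      m (∁ V ∪ (B ∩ V)) * m (∁ V ∪ (U ∩ ∁ B))       ≡⟨ cong (λ X → m X * m (∁ V ∪ (U ∩ ∁ B))) A∪F≡B ⟩
      m B * m (∁ V ∪ (U ∩ ∁ B))                     ∎
      where
      open ≡-Reasoning

      ∁V⊆B : ∁ V ⊆ B
      ∁V⊆B {x} x∈∁V with x ∈? B
      ... | yes x∈B = x∈B
      ... | no x∉B = ⊥-elim (x∈∁p⇒x∉p x∈∁V (∁B⊆V (x∉p⇒x∈∁p x∉B)))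

      A∪F≡B : ∁ V ∪ (B ∩ V) ≡ B
      A∪F≡B = trans (cong (λ X → ∁ V ∪ (B ∩ X)) (sym (∁∁ V))) (⊆⇒∪∩∁≡ ∁V⊆B)

      A∪F∪T≡U : (∁ V ∪ (B ∩ V)) ∪ (U ∩ ∁ B) ≡ U
      A∪F∪T≡U = trans (cong (_∪ (U ∩ ∁ B)) A∪F≡B) (⊆⇒∪∩∁≡ B⊆U)

      A∩F≡⊥ : ∁ V ∩ (B ∩ V) ≡ ⊥
      A∩F≡⊥ = disjoint (λ x∈∁V x∈B∩V → x∈∁p⇒x∉p x∈∁V (p∩q⊆q B V x∈B∩V))
      A∩T≡⊥ : ∁ V ∩ (U ∩ ∁ B) ≡ ⊥
      A∩T≡⊥ = disjoint (λ x∈∁V x∈U∖B → x∈∁p⇒x∉p (p∩q⊆q U _ x∈U∖B) (∁V⊆B x∈∁V))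
      F∩T≡⊥ : (B ∩ V) ∩ (U ∩ ∁ B) ≡ ⊥
      F∩T≡⊥ = disjoint (λ x∈B∩V x∈U∖B → x∈∁p⇒x∉p (p∩q⊆q U _ x∈U∖B) (p∩q⊆p B V x∈B∩V))

      rank : ∀ C → ∁ V ⊆ C → C ⊆ (∁ V ∪ (B ∩ V)) ∪ (U ∩ ∁ B) → rk C ≡ rk (∁ V) + ∣ C ∩ (B ∩ V) ∣
      rank C ∁V⊆C C⊆A∪F∪T = begin
        rk C                                   ≡⟨ rk-spanned ∁V⊆B dualActive ∁V⊆C C∖B⊆E ⟩
        ∣ C ∩ B ∣                              ≡⟨ ∣∩∣+∣∩∁∣ (C ∩ B) V ⟨
        ∣ (C ∩ B) ∩ V ∣ + ∣ (C ∩ B) ∩ ∁ V ∣    ≡⟨ cong₂ (λ X Y → ∣ X ∣ + ∣ Y ∣) (∩-assoc C B V) (⊆⇒∩≡ ∁V⊆C∩B) ⟩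
        ∣ C ∩ (B ∩ V) ∣ + ∣ ∁ V ∣              ≡⟨ +-comm ∣ C ∩ (B ∩ V) ∣ ∣ ∁ V ∣ ⟩
        ∣ ∁ V ∣ + ∣ C ∩ (B ∩ V) ∣              ≡⟨ cong (_+ ∣ C ∩ (B ∩ V) ∣) (rk-independent ∁V⊆B) ⟨
        rk (∁ V) + ∣ C ∩ (B ∩ V) ∣             ∎
        where
        dualActive : ∀ {d} → d ∈ B → d ∉ ∁ V → d ∈ I
        dualActive d∈B d∉∁V = V∩B⊆I (x∉∁p⇒x∈p d∉∁V) (x∈p⇒x∉∁p d∈B) d∈B
        C∖B⊆E : ∀ {e} → e ∈ C → e ∉ B → e ∈ E
        C∖B⊆E {e} e∈C e∉B = U∖B⊆E (subst (e ∈_) A∪F∪T≡U (C⊆A∪F∪T e∈C)) e∉B (x∉p⇒x∈∁p e∉B)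
        ∁V⊆C∩B : ∁ V ⊆ C ∩ B
        ∁V⊆C∩B x∈∁V = x∈p∩q⁺ (∁V⊆C x∈∁V , ∁V⊆B x∈∁V)

module ClassCounts {n} (M : ArithmeticMatroid n) (B : Subset n) (isBasis : IsBasis M B) where
  open ArithmeticMatroid M
  open MatroidFacts M
  open Basis B isBasis
  open Inversion
  open ℤΣ
  open SubsetFacts
  open import Data.Integer using (ℤ; +_; 0ℤ; ∣_∣; _*_; _≤_; _≟_)
  open import Data.Integer.Properties using (pos-*; abs-*; *-zeroʳ)
  open import Data.Integer.Tactic.RingSolver using (solve-∀)
  import Data.Nat as ℕ
  import Data.Nat.Properties as ℕ
  open import Data.Fin.Subset using (⊤; _∪_; _∩_; ∁; _⊆_)
  open import Data.Fin.Subset.Properties using (⊆⊤; ∈⊤; x∈∁p⇒x∉p; x∉∁p⇒x∈p)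

  μ≥0 : ∀ T → B ⊆ T → 0ℤ ≤ altSum (λ U → + m U) T ⊤
  μ≥0 T B⊆T = ax4 T ⊤ ⊆⊤ (ℕ.≤-antisym (rk-mono T ⊤ ⊆⊤)
                                      (ℕ.≤-trans (ℕ.≤-reflexive (sym (proj₂ isBasis))) (rk-mono B T B⊆T)))

  μ*≥0 : ∀ T → ∁ B ⊆ T → 0ℤ ≤ altSum (λ U → + m (∁ U)) T ⊤
  μ*≥0 T ∁B⊆T = ax5 T ⊤ ⊆⊤ (trans (rk*-cobasis T ∁T⊆B) (sym (rk*-cobasis ⊤ ∁⊤⊆B)))
    where
    ∁T⊆B : ∁ T ⊆ B
    ∁T⊆B x∈∁T = x∉∁p⇒x∈p (x∈∁p⇒x∉p x∈∁T ∘ ∁B⊆T)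
    ∁⊤⊆B : ∁ ⊤ ⊆ B
    ∁⊤⊆B x∈∁⊤ = ⊥-elim (x∈∁p⇒x∉p x∈∁⊤ ∈⊤)

  total : ℕΣ.∑ₛ (mult M B) ≡ m B
  total = ∑ₛ-multiplicity m B μ≥0

  dual-total : ℕΣ.∑ₛ (dmult M B) ≡ m B
  dual-total = trans (∑ₛ-multiplicity (m ∘ ∁) (∁ B) μ*≥0) (cong m (∁∁ B))

  κ : Subset n → Subset n → ℤ
  κ α U = kernel B (∁ B) E α U

  κ* : Subset n → Subset n → ℤ
  κ* β V = kernel (∁ B) B I β V

  term-factor : ∀ α β U V → (κ α U * + m U) * (κ* β V * + m (∁ V))
                            ≡ + m B * ((κ α U * κ* β V) * + m (∁ V ∪ (U ∩ ∁ B)))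
  term-factor α β U V = begin
    (κ α U * + m U) * (κ* β V * + m (∁ V))             ≡⟨ interchange (κ α U) (+ m U) (κ* β V) (+ m (∁ V)) ⟩
    (κ α U * κ* β V) * (+ m U * + m (∁ V))              ≡⟨ cong (κ α U * κ* β V *_) (pos-* (m U) (m (∁ V))) ⟨
    (κ α U * κ* β V) * + (m U ℕ.* m (∁ V))              ≡⟨ on-support ⟩
    (κ α U * κ* β V) * + (m B ℕ.* m (∁ V ∪ (U ∩ ∁ B)))  ≡⟨ cong (κ α U * κ* β V *_) (pos-* (m B) _) ⟩
    (κ α U * κ* β V) * (+ m B * + m (∁ V ∪ (U ∩ ∁ B)))  ≡⟨ swap (κ α U * κ* β V) (+ m B) (+ m (∁ V ∪ (U ∩ ∁ B))) ⟩
    + m B * ((κ α U * κ* β V) * + m (∁ V ∪ (U ∩ ∁ B)))  ∎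
    where
    open ≡-Reasoning
    interchange : ∀ a b c d → (a * b) * (c * d) ≡ (a * c) * (b * d)
    interchange = solve-∀
    swap : ∀ a b c → a * (b * c) ≡ b * (a * c)
    swap = solve-∀
    on-support : (κ α U * κ* β V) * + (m U ℕ.* m (∁ V)) ≡ (κ α U * κ* β V) * + (m B ℕ.* m (∁ V ∪ (U ∩ ∁ B)))
    on-support with κ α U * κ* β V ≟ 0ℤ
    ... | yes κκ*≡0 rewrite κκ*≡0 = refl
    ... | no κκ*≢0 = cong (λ k → κ α U * κ* β V * + k)
                          (m-exchange (kernel≢0⇒⊆ B (∁ B) E α U κ≢0) (kernel≢0⇒⊆E B (∁ B) E α U κ≢0)
                                      (kernel≢0⇒⊆ (∁ B) B I β V κ*≢0) (kernel≢0⇒⊆E (∁ B) B I β V κ*≢0))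
      where
      κ≢0 : κ α U ≢ 0ℤ
      κ≢0 κ≡0 = κκ*≢0 (cong (_* κ* β V) κ≡0)
      κ*≢0 : κ* β V ≢ 0ℤ
      κ*≢0 κ*≡0 = κκ*≢0 (trans (cong (κ α U *_) κ*≡0) (*-zeroʳ (κ α U)))

  m∣nB*nB* : ∀ α β → m B ∣ nB M B α ℕ.* nB* M B β
  m∣nB*nB* α β = divides ∣ K ∣ (begin
    nB M B α ℕ.* nB* M B β      ≡⟨ cong ∣_∣ product ⟩
    ∣ + m B * K ∣               ≡⟨ abs-* (+ m B) K ⟩
    m B ℕ.* ∣ K ∣               ≡⟨ ℕ.*-comm (m B) ∣ K ∣ ⟩
    ∣ K ∣ ℕ.* m B               ∎)
    where
    open ≡-Reasoning
    K = ∑ₛ (λ U → ∑ₛ (λ V → (κ α U * κ* β V) * + m (∁ V ∪ (U ∩ ∁ B))))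
    product : + (nB M B α ℕ.* nB* M B β) ≡ + m B * K
    product = begin
      + (nB M B α ℕ.* nB* M B β)
        ≡⟨ pos-* (nB M B α) (nB* M B β) ⟩
      + nB M B α * + nB* M B β
        ≡⟨ cong₂ _*_ (count-classes m B (∁ B) E α μ≥0) (count-classes (m ∘ ∁) (∁ B) B I β μ*≥0) ⟩
      ∑ₛ (λ U → κ α U * + m U) * ∑ₛ (λ V → κ* β V * + m (∁ V))
        ≡⟨ ∑ₛ-*ʳ (∑ₛ (λ V → κ* β V * + m (∁ V))) (λ U → κ α U * + m U) ⟨
      ∑ₛ (λ U → (κ α U * + m U) * ∑ₛ (λ V → κ* β V * + m (∁ V)))
        ≡⟨ ∑ₛ-cong (λ U → ∑ₛ-*ˡ (κ α U * + m U) (λ V → κ* β V * + m (∁ V))) ⟨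
      ∑ₛ (λ U → ∑ₛ (λ V → (κ α U * + m U) * (κ* β V * + m (∁ V))))
        ≡⟨ ∑ₛ-cong (λ U → ∑ₛ-cong (λ V → term-factor α β U V)) ⟩
      ∑ₛ (λ U → ∑ₛ (λ V → + m B * ((κ α U * κ* β V) * + m (∁ V ∪ (U ∩ ∁ B)))))
        ≡⟨ ∑ₛ-cong (λ U → ∑ₛ-*ˡ (+ m B) (λ V → (κ α U * κ* β V) * + m (∁ V ∪ (U ∩ ∁ B)))) ⟩
      ∑ₛ (λ U → + m B * ∑ₛ (λ V → (κ α U * κ* β V) * + m (∁ V ∪ (U ∩ ∁ B))))
        ≡⟨ ∑ₛ-*ˡ (+ m B) (λ U → ∑ₛ (λ V → (κ α U * κ* β V) * + m (∁ V ∪ (U ∩ ∁ B)))) ⟩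
      + m B * K ∎

open Enumeration using (realise-copies)
open import Data.Nat using (_*_; >-nonZero)

mainTheorem2 : (n : ℕ) (M : ArithmeticMatroid n) (B : Subset n) →
    IsBasis M B →
    Σ (Copies M B ⤖ DualCopies M B) (λ ψ →
      (α β : Subset n) →
        count (λ x → does (cls M B x ≟ₛ α) ∧ does (dcls M B (Bijection.to ψ x) ≟ₛ β))
              (copiesList M B)
          * ArithmeticMatroid.m M B
        ≡ nB M B α * nB* M B β)
mainTheorem2 n M B isBasis =
  realise-copies {{>-nonZero (m-pos B)}} (mult M B) (dmult M B) total dual-total (cls M B) (dcls M B) m∣nB*nB*
  where
  open ArithmeticMatroid M using (m-pos)
  open ClassCounts M B isBasis
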